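{- Let $\mathbf a=(a_1,\dots,a_n)\in\mathbb Z_{>0}^n$ and let $K_{n+1}$ be the complete graph on $\{0,\dots,n\}$ with edges directed from $i$ to $j$ when $i>j$. Then \[\operatorname{Ehr}_{q,0}(\mathcal F_{K_{n+1}}(\mathbf a))=q^{a_1+2a_2+\cdots+na_n-\binom{n+1}{2}}[n]_q!,\] where $[n]_q!=[n]_q[n-1]_q\cdots[1]_q$. In particular $\operatorname{Ehr}_{q,0}(\mathcal F_{K_{n+1}}(1,\dots,1))=[n]_q!$.
   Context: $\mathcal F_G(\mathbf a)$ is the set of $x\in\mathbb R_{\ge0}^E$ such that for each vertex $k\ge1$ the flow out of $k$ (on edges to smaller vertices) minus the flow into $k$ equals $a_k$, and the net flow at $0$ is $-\sum a_i$. $wt_{q,t}(b)=\frac{q^b-t^b}{q-t}$ for $b>0$, $wt_{q,t}(0)=1$; for an integer flow $A=(a_{ij})$, $wt_{q,t}(A)=(-(1-t)(1-q))^{\#\{a_{ij}>0\}-n}\prod wt_{q,t}(a_{ij})$; $\operatorname{Ehr}_{q,t}(\mathcal F_G(\mathbf a))=\sum_{A\in\mathcal F_G(\mathbf a)\cap\mathbb Z^E}wt_{q,t}(A)$. $[k]_q=1+q+\dots+q^{k-1}$. -}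

module Defs where

open import Level using (Level)
open import Data.Bool using (Bool; true; false; _∧_; if_then_else_)
open import Data.Nat as ℕ using (ℕ; zero; suc; _≡ᵇ_; _∸_)
open import Data.Fin as F using (Fin; zero; suc; toℕ; _<?_)
open import Data.Fin.Properties using () renaming (_≟_ to _≟F_)
open import Data.Product using (_×_; _,_; proj₁; proj₂)
open import Data.List as L using (List; []; _∷_; map; concatMap; filter; allFin; upTo; length)
open import Data.Nat.ListAction using (sum)
open import Data.Bool.ListAction using (and)
open import Data.Nat.Combinatorics using (_C_)
open import Relation.Nullary.Decidable using (T?)
open import Algebra.Bundles using (CommutativeRing)

Edge : ℕ → Set
Edge n = Fin (suc n) × Fin (suc n)

edges : (n : ℕ) → List (Edge n)
edges n = concatMap (λ i → map (λ j → (i , j)) (filter (_<? i) (allFin (suc n))))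
                    (allFin (suc n))

Labelling : ℕ → Set
Labelling n = List (Edge n × ℕ)

labellings : {n : ℕ} → List (Edge n) → ℕ → List (Labelling n)
labellings []       S = [] ∷ []
labellings (e ∷ es) S =
  concatMap (λ v → map ((e , v) ∷_) (labellings es S)) (upTo (suc S))

outflow : {n : ℕ} → Fin (suc n) → Labelling n → ℕ
outflow k A = sum (map proj₂ (filter (λ e → proj₁ (proj₁ e) ≟F k) A))

inflow : {n : ℕ} → Fin (suc n) → Labelling n → ℕ
inflow k A = sum (map proj₂ (filter (λ e → proj₂ (proj₁ e) ≟F k) A))

sumF : {n : ℕ} → (Fin n → ℕ) → ℕ
sumF {n} a = sum (map a (allFin n))

-- A ∈ F_{K_{n+1}}(a) ∩ ℤ^E :  for each k ≥ 1, out(k) − in(k) = a_k,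
-- and net flow at 0 equals −Σ a_i  (vertex k ≥ 1 carries a (k−1)).
isFlow : {n : ℕ} → (Fin n → ℕ) → Labelling n → Bool
isFlow {n} a A =
  and (map (λ k → outflow (suc k) A ≡ᵇ (a k ℕ.+ inflow (suc k) A)) (allFin n))
  ∧ ((outflow zero A ℕ.+ sumF a) ≡ᵇ inflow zero A)

-- Every integer point of F_{K_{n+1}}(a) has all edge values ≤ Σ a_i
-- (total flow reaching the sink 0), so this list enumerates exactly the
-- integer flows, each once.
integerFlows : (n : ℕ) → (Fin n → ℕ) → List (Labelling n)
integerFlows n a = filter (λ A → T? (isFlow a A)) (labellings (edges n) (sumF a))

module Weights {c ℓ : Level} (R : CommutativeRing c ℓ) where
  open CommutativeRing R

  pow : Carrier → ℕ → Carrier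
  pow x zero    = 1#
  pow x (suc k) = x * pow x k

  sumR : List Carrier → Carrier
  sumR = L.foldr _+_ 0#

  prodR : List Carrier → Carrier
  prodR = L.foldr _*_ 1#

  -- wt_{q,t}(b) = (q^b − t^b)/(q − t) = Σ_{i=0}^{b−1} q^i t^{b−1−i} for b > 0; wt(0) = 1
  wt : Carrier → Carrier → ℕ → Carrier
  wt q t zero    = 1#
  wt q t (suc b) = sumR (map (λ i → pow q i * pow t (b ∸ i)) (upTo (suc b)))

  numPositive : {n : ℕ} → Labelling n → ℕ
  numPositive A = length (filter (λ e → 1 ℕ.≤? proj₂ e) A)
    where import Data.Nat

  -- wt_{q,t}(A) = (−(1−t)(1−q))^{#{a_ij>0} − n} ∏ wt_{q,t}(a_ij)
  -- (the exponent is ≥ 0 for every flow with all a_k > 0)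
  wtFlow : Carrier → Carrier → (n : ℕ) → Labelling n → Carrier
  wtFlow q t n A =
    pow (- ((1# - t) * (1# - q))) (numPositive A ∸ n)
    * prodR (map (λ e → wt q t (proj₂ e)) A)

  Ehr : Carrier → Carrier → (n : ℕ) → (Fin n → ℕ) → Carrier
  Ehr q t n a = sumR (map (wtFlow q t n) (integerFlows n a))

  qint : Carrier → ℕ → Carrier
  qint q k = sumR (map (pow q) (upTo k))

  qfact : Carrier → ℕ → Carrier
  qfact q zero    = 1#
  qfact q (suc k) = qint q (suc k) * qfact q k

weightedSum : {n : ℕ} → (Fin n → ℕ) → ℕ
weightedSum {n} a = sum (map (λ i → suc (toℕ i) ℕ.* a i) (allFin n))

{-# OPTIONS --safe #-}
-- At t = 0 an edge value b > 0 has weight q^(b-1), and a flow carries the sign factor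
-- κ^(#positive edges - n) with κ = q - 1.  Write Ehr as a nested sum over the edge values,
-- ordered (by a permutation of the edge list) so that the edges leaving the top vertex m
-- come outermost.  Their values x_0, …, x_(m-1) must add up to a_m, and their only other
-- effect is to raise the demand of each lower vertex j by x_j.  By induction the lower
-- vertices then contribute q^(Σ_j j (a_j + x_j - 1)) [m-1]_q!, so the top vertex contributes
-- Σ_x κ^(#positive(x) - 1) ∏_j wt(x_j) q^(j x_j).  Adding the edges one at a time, this sum
-- telescopes through 1 + κ [r]_q = q^r to q^(m (a_m - 1)) [m]_q.
module Submission where

open import Defs
open import Level using (Level)
open import Data.Nat using (ℕ; zero; suc; _<_; _∸_)
open import Data.Nat.Combinatorics using (_C_)
open import Data.Fin using (Fin)
open import Data.Product using (_×_; _,_)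
open import Algebra.Bundles using (CommutativeRing)

module Ranges where
  open import Data.Bool using (Bool; true; false; _∧_; if_then_else_; T)
  open import Data.Bool.Properties using (∧-identityʳ; T-∧)
  open import Data.Bool.ListAction using (and)
  open import Data.Nat
  open import Data.Nat.Properties
  open import Data.Nat.Combinatorics using (nCk+nC[k+1]≡[n+1]C[k+1]; nC1≡n)
  open import Data.Nat.ListAction using (sum)
  open import Data.Nat.ListAction.Properties using (sum-++)
  open import Data.Nat.Tactic.RingSolver using (solve-∀)
  open import Data.Fin using (toℕ)
  open import Data.List using ([]; _∷_; _++_; map; filter; upTo; applyUpTo; allFin; tabulate)
  open import Data.List.Properties using (upTo-∷ʳ; map-++; map-tabulate; map-upTo; map-∘; filter-all; filter-++; filter-reject; ++-identityʳ)
  open import Data.List.Relation.Unary.All.Properties using (applyUpTo⁺₁)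
  open import Data.Product using (_,_)
  open import Data.Sum using (inj₁; inj₂)
  open import Function using (_∘_)
  open import Function.Bundles using (Equivalence)
  open import Relation.Nullary using (Dec; does)
  open import Relation.Nullary.Decidable using (dec-true; dec-false)
  open import Relation.Binary.PropositionalEquality

  sumBelow : ℕ → (ℕ → ℕ) → ℕ
  sumBelow zero    f = 0
  sumBelow (suc m) f = sumBelow m f + f m

  syntax sumBelow m (λ j → e) = ∑ℕ[ j < m ] e

  sumBelow-cong : ∀ m {f g : ℕ → ℕ} → (∀ j → j < m → f j ≡ g j) → sumBelow m f ≡ sumBelow m g
  sumBelow-cong zero    eq = refl
  sumBelow-cong (suc m) eq = cong₂ _+_ (sumBelow-cong m (λ j j<m → eq j (m<n⇒m<1+n j<m))) (eq m ≤-refl)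

  sumBelow-+ : ∀ m (f g : ℕ → ℕ) → ∑ℕ[ j < m ] (f j + g j) ≡ sumBelow m f + sumBelow m g
  sumBelow-+ zero    f g = refl
  sumBelow-+ (suc m) f g = trans (cong (_+ (f m + g m)) (sumBelow-+ m f g)) (interchange (sumBelow m f) (sumBelow m g) (f m) (g m))
    where
    interchange : ∀ a b c d → (a + b) + (c + d) ≡ (a + c) + (b + d)
    interchange = solve-∀

  sumBelow-suc : ∀ m (f : ℕ → ℕ) → sumBelow (suc m) f ≡ f 0 + ∑ℕ[ j < m ] f (suc j)
  sumBelow-suc zero    f = +-comm 0 (f 0)
  sumBelow-suc (suc m) f = trans (cong (_+ f (suc m)) (sumBelow-suc m f)) (+-assoc (f 0) _ _)

  sumBelow-zero : ∀ m {f : ℕ → ℕ} → (∀ j → j < m → f j ≡ 0) → sumBelow m f ≡ 0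
  sumBelow-zero zero    eq = refl
  sumBelow-zero (suc m) eq = cong₂ _+_ (sumBelow-zero m (λ j j<m → eq j (m<n⇒m<1+n j<m))) (eq m ≤-refl)

  pointMass : ℕ → ℕ → ℕ → ℕ
  pointMass x v j = if x ≡ᵇ j then v else 0

  pointMass-≡ : ∀ x v → pointMass x v x ≡ v
  pointMass-≡ x v rewrite dec-true (x ≟ x) refl = refl

  pointMass-≢ : ∀ {x j} v → x ≢ j → pointMass x v j ≡ 0
  pointMass-≢ {x} {j} v x≢j rewrite dec-false (x ≟ j) x≢j = refl

  private
    pointMass-vanishes : ∀ {g : ℕ → ℕ → ℕ} → (∀ j → g j 0 ≡ 0) → ∀ {x j} v → x ≢ j → g j (pointMass x v j) ≡ 0
    pointMass-vanishes {g} g0 {j = j} v x≢j = trans (cong (g j) (pointMass-≢ v x≢j)) (g0 j)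

  sumBelow-pointMass : ∀ m (g : ℕ → ℕ → ℕ) → (∀ j → g j 0 ≡ 0) → ∀ {x} v → x < m →
                       ∑ℕ[ j < m ] g j (pointMass x v j) ≡ g x v
  sumBelow-pointMass (suc m) g g0 {x} v x<1+m with m≤n⇒m<n∨m≡n (≤-pred x<1+m)
  ... | inj₁ x<m =
    trans (cong₂ _+_ (sumBelow-pointMass m g g0 v x<m) (pointMass-vanishes {g} g0 v (<⇒≢ x<m))) (+-identityʳ _)
  ... | inj₂ refl =
    cong₂ _+_ (sumBelow-zero m (λ j j<m → pointMass-vanishes {g} g0 v (>⇒≢ j<m))) (cong (g m) (pointMass-≡ m v))

  sum-map-upTo : ∀ m (f : ℕ → ℕ) → sum (map f (upTo m)) ≡ sumBelow m f
  sum-map-upTo zero    f = refl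
  sum-map-upTo (suc m) f = begin
    sum (map f (upTo (suc m)))         ≡⟨ cong (sum ∘ map f) (upTo-∷ʳ m) ⟨
    sum (map f (upTo m ++ m ∷ []))     ≡⟨ cong sum (map-++ f (upTo m) (m ∷ [])) ⟩
    sum (map f (upTo m) ++ f m ∷ [])   ≡⟨ sum-++ (map f (upTo m)) (f m ∷ []) ⟩
    sum (map f (upTo m)) + (f m + 0)   ≡⟨ cong₂ _+_ (sum-map-upTo m f) (+-identityʳ (f m)) ⟩
    sumBelow m f + f m                 ∎
    where open ≡-Reasoning

  tabulate-toℕ : ∀ m → tabulate {n = m} toℕ ≡ upTo m
  tabulate-toℕ zero    = refl
  tabulate-toℕ (suc m) = cong (0 ∷_) (begin
    tabulate (suc ∘ toℕ)     ≡⟨ map-tabulate toℕ suc ⟨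
    map suc (tabulate toℕ)   ≡⟨ cong (map suc) (tabulate-toℕ m) ⟩
    map suc (upTo m)         ≡⟨ map-upTo suc m ⟩
    applyUpTo suc m          ∎)
    where open ≡-Reasoning

  map-toℕ-allFin : ∀ m → map toℕ (allFin m) ≡ upTo m
  map-toℕ-allFin m = trans (map-tabulate (λ i → i) toℕ) (tabulate-toℕ m)

  map-allFin-toℕ : ∀ {A : Set} (f : ℕ → A) m → map (f ∘ toℕ) (allFin m) ≡ map f (upTo m)
  map-allFin-toℕ f m = trans (map-∘ (allFin m)) (cong (map f) (map-toℕ-allFin m))

  sum-allFin-toℕ : ∀ m (f : ℕ → ℕ) → sum (map (f ∘ toℕ) (allFin m)) ≡ sumBelow m f
  sum-allFin-toℕ m f = trans (cong sum (map-allFin-toℕ f m)) (sum-map-upTo m f)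

  suc-C-2 : ∀ n → suc n C 2 ≡ ∑ℕ[ j < n ] suc j
  suc-C-2 zero    = refl
  suc-C-2 (suc n) = begin
    suc (suc n) C 2            ≡⟨ nCk+nC[k+1]≡[n+1]C[k+1] (suc n) 1 ⟨
    suc n C 1 + suc n C 2      ≡⟨ cong₂ _+_ (nC1≡n (suc n)) (suc-C-2 n) ⟩
    suc n + sumBelow n suc     ≡⟨ +-comm (suc n) _ ⟩
    sumBelow (suc n) suc       ∎
    where open ≡-Reasoning

  sumBelow-weighted-pred : ∀ m (f : ℕ → ℕ) → (∀ j → j < m → 1 ≤ f j) →
    ∑ℕ[ j < m ] (suc j * (f j ∸ 1)) ≡ ∑ℕ[ j < m ] (suc j * f j) ∸ ∑ℕ[ j < m ] suc j
  sumBelow-weighted-pred m f f≥1 = sym (begin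
    ∑ℕ[ j < m ] (suc j * f j) ∸ sumBelow m suc                           ≡⟨ cong (_∸ sumBelow m suc) (sumBelow-cong m split) ⟩
    ∑ℕ[ j < m ] (suc j * (f j ∸ 1) + suc j) ∸ sumBelow m suc             ≡⟨ cong (_∸ sumBelow m suc) (sumBelow-+ m _ suc) ⟩
    ∑ℕ[ j < m ] (suc j * (f j ∸ 1)) + sumBelow m suc ∸ sumBelow m suc     ≡⟨ m+n∸n≡m _ (sumBelow m suc) ⟩
    ∑ℕ[ j < m ] (suc j * (f j ∸ 1))                                      ∎)
    where
    open ≡-Reasoning
    split : ∀ j → j < m → suc j * f j ≡ suc j * (f j ∸ 1) + suc j
    split j j<m = begin
      suc j * f j                   ≡⟨ cong (suc j *_) (m∸n+n≡m (f≥1 j j<m)) ⟨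
      suc j * (f j ∸ 1 + 1)         ≡⟨ *-distribˡ-+ (suc j) (f j ∸ 1) 1 ⟩
      suc j * (f j ∸ 1) + suc j * 1 ≡⟨ cong (suc j * (f j ∸ 1) +_) (*-identityʳ (suc j)) ⟩
      suc j * (f j ∸ 1) + suc j     ∎

  allBelow : ℕ → (ℕ → Bool) → Bool
  allBelow zero    p = true
  allBelow (suc m) p = allBelow m p ∧ p m

  allBelow-cong : ∀ m {p p′ : ℕ → Bool} → (∀ j → j < m → p j ≡ p′ j) → allBelow m p ≡ allBelow m p′
  allBelow-cong zero    eq = refl
  allBelow-cong (suc m) eq = cong₂ _∧_ (allBelow-cong m (λ j j<m → eq j (m<n⇒m<1+n j<m))) (eq m ≤-refl)

  allBelow-T : ∀ m {p : ℕ → Bool} → T (allBelow m p) → ∀ j → j < m → T (p j)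
  allBelow-T (suc m) {p} all j j<1+m with Equivalence.to T-∧ all | m≤n⇒m<n∨m≡n (≤-pred j<1+m)
  ... | all-m , _  | inj₁ j<m  = allBelow-T m all-m j j<m
  ... | _    , p-m | inj₂ refl = p-m

  and-map-upTo : ∀ m (p : ℕ → Bool) → and (map p (upTo m)) ≡ allBelow m p
  and-map-upTo zero    p = refl
  and-map-upTo (suc m) p = begin
    and (map p (upTo (suc m)))          ≡⟨ cong (and ∘ map p) (upTo-∷ʳ m) ⟨
    and (map p (upTo m ++ m ∷ []))      ≡⟨ cong and (map-++ p (upTo m) (m ∷ [])) ⟩
    and (map p (upTo m) ++ p m ∷ [])    ≡⟨ and-++ (map p (upTo m)) ⟩
    and (map p (upTo m)) ∧ (p m ∧ true) ≡⟨ cong₂ _∧_ (and-map-upTo m p) (∧-identityʳ (p m)) ⟩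
    allBelow m p ∧ p m                  ∎
    where
    open ≡-Reasoning
    and-++ : ∀ xs {ys} → and (xs ++ ys) ≡ and xs ∧ and ys
    and-++ []           = refl
    and-++ (true ∷ xs)  = and-++ xs
    and-++ (false ∷ xs) = refl

  filter-map : ∀ {A B : Set} (f : A → B) {P : B → Set} (P? : ∀ y → Dec (P y)) xs →
               filter P? (map f xs) ≡ map f (filter (P? ∘ f) xs)
  filter-map f P? []       = refl
  filter-map f P? (x ∷ xs) with does (P? (f x))
  ... | true  = cong (f x ∷_) (filter-map f P? xs)
  ... | false = filter-map f P? xs

  filter-<-upTo : ∀ {t m} → t ≤ m → filter (_<? t) (upTo m) ≡ upTo t
  filter-<-upTo {m = zero} z≤n = refl
  filter-<-upTo {t} {suc m} t≤1+m with m≤n⇒m<n∨m≡n t≤1+m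
  ... | inj₂ refl = filter-all (_<? t) (applyUpTo⁺₁ (λ j → j) t (λ j<t → j<t))
  ... | inj₁ (s≤s t≤m) = begin
    filter (_<? t) (upTo (suc m))                      ≡⟨ cong (filter (_<? t)) (upTo-∷ʳ m) ⟨
    filter (_<? t) (upTo m ++ m ∷ [])                  ≡⟨ filter-++ (_<? t) (upTo m) (m ∷ []) ⟩
    filter (_<? t) (upTo m) ++ filter (_<? t) (m ∷ []) ≡⟨ cong₂ _++_ (filter-<-upTo t≤m) (filter-reject (_<? t) (≤⇒≯ t≤m)) ⟩
    upTo t ++ []                                       ≡⟨ ++-identityʳ (upTo t) ⟩
    upTo t                                             ∎
    where open ≡-Reasoning


open Ranges

module Flows where
  open import Data.Bool using (Bool; true; false; _∧_; T)
  open import Data.Bool.Properties using (T-≡)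
  open import Data.Bool.ListAction using (and)
  open import Data.Nat
  open import Data.Nat.Properties
  open import Data.Nat.ListAction using (sum)
  open import Data.Nat.Tactic.RingSolver using (solve-∀)
  open import Data.Fin as Fin using (toℕ; fromℕ<)
  import Data.Fin.Properties as Finₚ
  open import Data.Product using (_,_)
  open import Data.List using (List; []; _∷_; _++_; map; concatMap; filter; upTo; downFrom; allFin)
  import Data.List.Properties as List
  open import Data.List.Relation.Unary.All as All using (All; []; _∷_)
  open import Data.List.Relation.Unary.All.Properties using (++⁺; map⁺; applyDownFrom⁺₁)
  open import Data.List.Relation.Binary.Permutation.Propositional using (_↭_; ↭-reflexive; ↭-sym; ↭-trans)
  import Data.List.Relation.Binary.Permutation.Propositional.Properties as ↭
  open import Function using (_∘_)
  open import Function.Bundles using (Equivalence)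
  open import Relation.Nullary using (yes; no)
  open import Relation.Nullary.Negation using (contradiction)
  open import Relation.Binary.PropositionalEquality

  sgn : ℕ → ℕ
  sgn zero    = 0
  sgn (suc _) = 1

  -- A partial labelling only matters through the flow out of and into each vertex and
  -- its number of positive values.
  record Summary : Set where
    constructor summary
    field
      flowOut flowIn : ℕ → ℕ
      npos           : ℕ

  open Summary public

  infix 4 _≋_
  infixl 6 _⊕_

  _≋_ : Summary → Summary → Set
  s ≋ s′ = (∀ j → flowOut s j ≡ flowOut s′ j) × (∀ j → flowIn s j ≡ flowIn s′ j) × npos s ≡ npos s′

  ∅ : Summary
  ∅ = summary (λ _ → 0) (λ _ → 0) 0

  _⊕_ : Summary → Summary → Summary
  s ⊕ s′ = summary (λ j → flowOut s j + flowOut s′ j) (λ j → flowIn s j + flowIn s′ j) (npos s + npos s′)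

  along : ℕ × ℕ → ℕ → Summary
  along (x , y) v = summary (pointMass x v) (pointMass y v) (sgn v)

  ⊕-congʳ : ∀ {s s′} t → s ≋ s′ → s ⊕ t ≋ s′ ⊕ t
  ⊕-congʳ t (out , in′ , pos) = (λ j → cong (_+ flowOut t j) (out j)) , (λ j → cong (_+ flowIn t j) (in′ j)) , cong (_+ npos t) pos

  ⊕-assoc : ∀ s t u → s ⊕ t ⊕ u ≋ s ⊕ (t ⊕ u)
  ⊕-assoc s t u = (λ j → +-assoc (flowOut s j) _ _) , (λ j → +-assoc (flowIn s j) _ _) , +-assoc (npos s) _ _

  ⊕-identityʳ : ∀ s → s ⊕ ∅ ≋ s
  ⊕-identityʳ s = (λ j → +-identityʳ (flowOut s j)) , (λ j → +-identityʳ (flowIn s j)) , +-identityʳ (npos s)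

  ⊕-swapʳ : ∀ s t u → s ⊕ t ⊕ u ≋ s ⊕ u ⊕ t
  ⊕-swapʳ s t u = (λ j → swap (flowOut s j) _ _) , (λ j → swap (flowIn s j) _ _) , swap (npos s) _ _
    where
    swap : ∀ a b c → a + b + c ≡ a + c + b
    swap = solve-∀

  ≋-sym : ∀ {s s′} → s ≋ s′ → s′ ≋ s
  ≋-sym (out , in′ , pos) = (λ j → sym (out j)) , (λ j → sym (in′ j)) , sym pos

  Preserves : (Summary → Set) → ℕ × ℕ → Set
  Preserves P e = ∀ v {s} → P s → P (s ⊕ along e v)

  inflowWeight : ℕ → Summary → ℕ
  inflowWeight m s = ∑ℕ[ j < m ] (j * flowIn s j)

  inflowWeight-along : ∀ {m t} s v → t < m → inflowWeight m (s ⊕ along (m , t) v) ≡ inflowWeight m s + t * v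
  inflowWeight-along {m} {t} s v t<m = begin
    ∑ℕ[ j < m ] (j * (flowIn s j + pointMass t v j))             ≡⟨ sumBelow-cong m (λ j _ → *-distribˡ-+ j (flowIn s j) _) ⟩
    ∑ℕ[ j < m ] (j * flowIn s j + j * pointMass t v j)           ≡⟨ sumBelow-+ m _ _ ⟩
    inflowWeight m s + ∑ℕ[ j < m ] (j * pointMass t v j)         ≡⟨ cong (inflowWeight m s +_) (sumBelow-pointMass m _*_ *-zeroʳ v t<m) ⟩
    inflowWeight m s + t * v                                     ∎
    where open ≡-Reasoning

  balanced : ℕ → (ℕ → ℕ) → Summary → Bool
  balanced m a s = allBelow m (λ j → flowOut s (suc j) ≡ᵇ a (suc j) + flowIn s (suc j))

  balanced-≋ : ∀ m (a : ℕ → ℕ) {s s′} → s ≋ s′ → balanced m a s ≡ balanced m a s′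
  balanced-≋ m a (out , in′ , _) = allBelow-cong m λ j _ → cong₂ _≡ᵇ_ (out (suc j)) (cong (a (suc j) +_) (in′ (suc j)))

  balanced-⊕ : ∀ m (a : ℕ → ℕ) s s′ → (∀ j → j < m → flowOut s (suc j) ≡ 0) →
               balanced m a (s ⊕ s′) ≡ balanced m (λ j → a j + flowIn s j) s′
  balanced-⊕ m a s s′ noOut = allBelow-cong m λ j j<m →
    cong₂ _≡ᵇ_ (cong (_+ flowOut s′ (suc j)) (noOut j j<m)) (sym (+-assoc (a (suc j)) (flowIn s (suc j)) _))

  demandSum : ℕ → (ℕ → ℕ) → ℕ
  demandSum m a = ∑ℕ[ j < m ] a (suc j)

  excess : ℕ → (ℕ → ℕ) → ℕ
  excess m a = ∑ℕ[ j < m ] (suc j * (a (suc j) ∸ 1))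

  excess-+ : ∀ m (a b : ℕ → ℕ) → (∀ j → j < m → 1 ≤ a (suc j)) →
             excess m (λ j → a j + b j) ≡ excess m a + ∑ℕ[ j < suc m ] (j * b j)
  excess-+ m a b a≥1 = begin
    ∑ℕ[ j < m ] (suc j * (a (suc j) + b (suc j) ∸ 1))                 ≡⟨ sumBelow-cong m (λ j j<m → cong (suc j *_) (+-∸-comm (b (suc j)) (a≥1 j j<m))) ⟩
    ∑ℕ[ j < m ] (suc j * (a (suc j) ∸ 1 + b (suc j)))                 ≡⟨ sumBelow-cong m (λ j _ → *-distribˡ-+ (suc j) (a (suc j) ∸ 1) (b (suc j))) ⟩
    ∑ℕ[ j < m ] (suc j * (a (suc j) ∸ 1) + suc j * b (suc j))         ≡⟨ sumBelow-+ m (λ j → suc j * (a (suc j) ∸ 1)) (λ j → suc j * b (suc j)) ⟩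
    excess m a + ∑ℕ[ j < m ] (suc j * b (suc j))                      ≡⟨ cong (excess m a +_) (sumBelow-suc m (λ j → j * b j)) ⟨
    excess m a + ∑ℕ[ j < suc m ] (j * b j)                            ∎
    where open ≡-Reasoning

  demandSum-+ : ∀ m (a b : ℕ → ℕ) → demandSum m (λ j → a j + b j) ≤ demandSum m a + ∑ℕ[ j < suc m ] b j
  demandSum-+ m a b = begin
    demandSum m (λ j → a j + b j)                ≡⟨ sumBelow-+ m (a ∘ suc) (b ∘ suc) ⟩
    demandSum m a + ∑ℕ[ j < m ] b (suc j)        ≤⟨ +-monoʳ-≤ (demandSum m a) (m≤n+m _ (b 0)) ⟩
    demandSum m a + (b 0 + ∑ℕ[ j < m ] b (suc j)) ≡⟨ cong (demandSum m a +_) (sumBelow-suc m b) ⟨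
    demandSum m a + ∑ℕ[ j < suc m ] b j          ∎
    where open ≤-Reasoning

  d+[p+p′]∸[1+m] : ∀ d {p} p′ m → 1 ≤ p → (d + (p + p′)) ∸ suc m ≡ (d + p ∸ 1 + p′) ∸ m
  d+[p+p′]∸[1+m] d {suc p} p′ m _ = begin
    d + (suc p + p′) ∸ suc m   ≡⟨ cong (_∸ suc m) (+-suc d (p + p′)) ⟩
    d + (p + p′) ∸ m           ≡⟨ cong (_∸ m) (+-assoc d p p′) ⟨
    d + p + p′ ∸ m             ≡⟨ cong (λ k → k ∸ 1 + p′ ∸ m) (+-suc d p) ⟨
    d + suc p ∸ 1 + p′ ∸ m     ∎
    where open ≡-Reasoning

  outEdgesDown : ℕ → List (ℕ × ℕ)
  outEdgesDown m = map (m ,_) (downFrom m)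

  edgesDown : ℕ → List (ℕ × ℕ)
  edgesDown zero    = []
  edgesDown (suc m) = outEdgesDown (suc m) ++ edgesDown m

  EdgeBelow : ℕ → ℕ × ℕ → Set
  EdgeBelow m (x , y) = y < x × x ≤ m

  edgesBelow : ∀ m → All (EdgeBelow m) (edgesDown m)
  edgesBelow zero    = []
  edgesBelow (suc m) = ++⁺ (map⁺ (applyDownFrom⁺₁ (λ j → j) (suc m) (λ j<1+m → j<1+m , ≤-refl)))
                                (All.map (λ { (y<x , x≤m) → y<x , m≤n⇒m≤1+n x≤m }) (edgesBelow m))

  edgeToℕ : ∀ {n} → Edge n → ℕ × ℕ
  edgeToℕ (x , y) = toℕ x , toℕ y

  outEdgesUp : ℕ → List (ℕ × ℕ)
  outEdgesUp m = map (m ,_) (upTo m)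

  edgesUp : ℕ → List (ℕ × ℕ)
  edgesUp n = concatMap outEdgesUp (upTo (suc n))

  map-edgeToℕ-edges : ∀ n → map edgeToℕ (edges n) ≡ edgesUp n
  map-edgeToℕ-edges n = begin
    map edgeToℕ (edges n)                                                   ≡⟨ List.map-concatMap edgeToℕ _ (allFin (suc n)) ⟩
    concatMap (map edgeToℕ ∘ λ i → map (i ,_) (filter (Finₚ._<? i) (allFin (suc n)))) (allFin (suc n))
                                                                            ≡⟨ List.concatMap-cong below (allFin (suc n)) ⟩
    concatMap (outEdgesUp ∘ toℕ) (allFin (suc n))                           ≡⟨ List.concatMap-map outEdgesUp toℕ (allFin (suc n)) ⟨
    concatMap outEdgesUp (map toℕ (allFin (suc n)))                         ≡⟨ cong (concatMap outEdgesUp) (map-toℕ-allFin (suc n)) ⟩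
    edgesUp n                                                               ∎
    where
    open ≡-Reasoning
    below : ∀ i → map edgeToℕ (map (i ,_) (filter (Finₚ._<? i) (allFin (suc n)))) ≡ map (toℕ i ,_) (upTo (toℕ i))
    below i = begin
      map edgeToℕ (map (i ,_) (filter (Finₚ._<? i) (allFin (suc n))))   ≡⟨ List.map-∘ _ ⟨
      map ((toℕ i ,_) ∘ toℕ) (filter (Finₚ._<? i) (allFin (suc n)))     ≡⟨ List.map-∘ _ ⟩
      map (toℕ i ,_) (map toℕ (filter (Finₚ._<? i) (allFin (suc n))))   ≡⟨ cong (map (toℕ i ,_)) (filter-map toℕ (_<? toℕ i) (allFin (suc n))) ⟨
      map (toℕ i ,_) (filter (_<? toℕ i) (map toℕ (allFin (suc n))))
        ≡⟨ cong (map (toℕ i ,_) ∘ filter (_<? toℕ i)) (map-toℕ-allFin (suc n)) ⟩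
      map (toℕ i ,_) (filter (_<? toℕ i) (upTo (suc n)))         ≡⟨ cong (map (toℕ i ,_)) (filter-<-upTo (<⇒≤ (Finₚ.toℕ<n i))) ⟩
      map (toℕ i ,_) (upTo (toℕ i))                                ∎

  edgesUp↭edgesDown : ∀ n → edgesUp n ↭ edgesDown n
  edgesUp↭edgesDown zero    = ↭-reflexive refl
  edgesUp↭edgesDown (suc n) = ↭-trans (↭-reflexive split) (↭-trans (↭.++-comm (edgesUp n) _) (↭.++⁺ top (edgesUp↭edgesDown n)))
    where
    split : edgesUp (suc n) ≡ edgesUp n ++ (outEdgesUp (suc n) ++ [])
    split = trans (cong (concatMap outEdgesUp) (sym (List.upTo-∷ʳ (suc n)))) (List.concatMap-++ outEdgesUp (upTo (suc n)) (suc n ∷ []))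
    top : outEdgesUp (suc n) ++ [] ↭ outEdgesDown (suc n)
    top = ↭-trans (↭-reflexive (List.++-identityʳ _))
                  (↭.map⁺ (suc n ,_) (↭-trans (↭-sym (↭.↭-reverse (upTo (suc n)))) (↭-reflexive (List.reverse-upTo (suc n)))))

  -- Invariant of the summaries reached from ∅ along the out-edges of m.
  record TopVertexState (m : ℕ) (s : Summary) : Set where
    field
      outElsewhere : ∀ j → j ≢ m → flowOut s j ≡ 0
      noInflowAtTop : flowIn s m ≡ 0
      outflow≡inflow : flowOut s m ≡ ∑ℕ[ j < m ] flowIn s j
      positive : 0 < flowOut s m → 0 < npos s

  topVertexState-∅ : ∀ m → TopVertexState m ∅
  topVertexState-∅ m = record
    { outElsewhere = λ _ _ → refl
    ; noInflowAtTop = refl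
    ; outflow≡inflow = sym (sumBelow-zero m (λ _ _ → refl))
    ; positive = λ () }

  topVertexState-along : ∀ {m t} → t < m → Preserves (TopVertexState m) (m , t)
  topVertexState-along {m} {t} t<m v {s} st = record
    { outElsewhere = λ j j≢m → cong₂ _+_ (outElsewhere j j≢m) (pointMass-≢ v (≢-sym j≢m))
    ; noInflowAtTop = cong₂ _+_ noInflowAtTop (pointMass-≢ v (<⇒≢ t<m))
    ; outflow≡inflow = begin
        flowOut s m + pointMass m v m                        ≡⟨ cong₂ _+_ outflow≡inflow (pointMass-≡ m v) ⟩
        ∑ℕ[ j < m ] flowIn s j + v                           ≡⟨ cong (_ +_) (sumBelow-pointMass m (λ _ w → w) (λ _ → refl) v t<m) ⟨
        ∑ℕ[ j < m ] flowIn s j + ∑ℕ[ j < m ] pointMass t v j ≡⟨ sumBelow-+ m _ _ ⟨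
        ∑ℕ[ j < m ] (flowIn s j + pointMass t v j)           ∎
    ; positive = positive′ v }
    where
    open TopVertexState st
    open ≡-Reasoning
    positive′ : ∀ v → 0 < flowOut s m + pointMass m v m → 0 < npos s + sgn v
    positive′ zero    0<out = ≤-trans (positive (subst (0 <_) (trans (cong (flowOut s m +_) (pointMass-≡ m 0)) (+-identityʳ _)) 0<out))
                                      (m≤m+n (npos s) 0)
    positive′ (suc v) _     = m≤n+m 1 (npos s)

  Untouched : ℕ → Summary → Set
  Untouched m s = flowOut s m ≡ 0 × flowIn s m ≡ 0

  untouched-along : ∀ {m} e → EdgeBelow m e → Preserves (Untouched (suc m)) e
  untouched-along {m} (x , y) (y<x , x≤m) v (out≡0 , in≡0) =
    trans (cong₂ _+_ out≡0 (pointMass-≢ v (<⇒≢ (s≤s x≤m)))) refl ,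
    trans (cong₂ _+_ in≡0 (pointMass-≢ v (<⇒≢ (<-≤-trans y<x (m≤n⇒m≤1+n x≤m))))) refl

  outEdgesDown-topVertexState : ∀ m → All (Preserves (TopVertexState m)) (outEdgesDown m)
  outEdgesDown-topVertexState m = map⁺ (applyDownFrom⁺₁ (λ t → t) m topVertexState-along)

  edgesDown-untouched : ∀ m → All (Preserves (Untouched (suc m))) (edgesDown m)
  edgesDown-untouched m = All.map (λ {e} → untouched-along e) (edgesBelow m)

  accumulate : ∀ {n} → Labelling n → Summary → Summary
  accumulate []            s = s
  accumulate ((e , v) ∷ A) s = accumulate A (s ⊕ along (edgeToℕ e) v)

  accumulate-flowOut : ∀ {n} (A : Labelling n) s k → flowOut (accumulate A s) (toℕ k) ≡ flowOut s (toℕ k) + outflow k A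
  accumulate-flowOut []                    s k = sym (+-identityʳ _)
  accumulate-flowOut (((x , y) , v) ∷ A) s k with x Finₚ.≟ k
  ... | yes refl = trans (accumulate-flowOut A _ x)
                         (trans (cong (λ w → flowOut s (toℕ x) + w + outflow x A) (pointMass-≡ (toℕ x) v)) (+-assoc (flowOut s (toℕ x)) v (outflow x A)))
  ... | no x≢k   = trans (accumulate-flowOut A _ k)
                         (trans (cong (λ w → flowOut s (toℕ k) + w + outflow k A) (pointMass-≢ v (x≢k ∘ Finₚ.toℕ-injective)))
                                (cong (_+ outflow k A) (+-identityʳ _)))

  accumulate-flowIn : ∀ {n} (A : Labelling n) s k → flowIn (accumulate A s) (toℕ k) ≡ flowIn s (toℕ k) + inflow k A
  accumulate-flowIn []                    s k = sym (+-identityʳ _)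
  accumulate-flowIn (((x , y) , v) ∷ A) s k with y Finₚ.≟ k
  ... | yes refl = trans (accumulate-flowIn A _ y)
                         (trans (cong (λ w → flowIn s (toℕ y) + w + inflow y A) (pointMass-≡ (toℕ y) v)) (+-assoc (flowIn s (toℕ y)) v (inflow y A)))
  ... | no y≢k   = trans (accumulate-flowIn A _ k)
                         (trans (cong (λ w → flowIn s (toℕ k) + w + inflow k A) (pointMass-≢ v (y≢k ∘ Finₚ.toℕ-injective)))
                                (cong (_+ inflow k A) (+-identityʳ _)))

  Conserved : ℕ → Summary → Set
  Conserved m s = ∑ℕ[ j < m ] flowOut s j ≡ ∑ℕ[ j < m ] flowIn s j

  conserved-along : ∀ {m x y} → x < m → y < m → Preserves (Conserved m) (x , y)
  conserved-along {m} {x} {y} x<m y<m v {s} conserved = begin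
    ∑ℕ[ j < m ] (flowOut s j + pointMass x v j)             ≡⟨ sumBelow-+ m (flowOut s) (pointMass x v) ⟩
    ∑ℕ[ j < m ] flowOut s j + ∑ℕ[ j < m ] pointMass x v j   ≡⟨ cong₂ _+_ conserved (sumBelow-pointMass m (λ _ w → w) (λ _ → refl) v x<m) ⟩
    ∑ℕ[ j < m ] flowIn s j + v                              ≡⟨ cong (_ +_) (sumBelow-pointMass m (λ _ w → w) (λ _ → refl) v y<m) ⟨
    ∑ℕ[ j < m ] flowIn s j + ∑ℕ[ j < m ] pointMass y v j    ≡⟨ sumBelow-+ m (flowIn s) (pointMass y v) ⟨
    ∑ℕ[ j < m ] (flowIn s j + pointMass y v j)              ∎
    where open ≡-Reasoning

  accumulate-conserved : ∀ {n} (A : Labelling n) {s} → Conserved (suc n) s → Conserved (suc n) (accumulate A s)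
  accumulate-conserved []                    conserved = conserved
  accumulate-conserved (((x , y) , v) ∷ A) {s} conserved =
    accumulate-conserved A (conserved-along (Finₚ.toℕ<n x) (Finₚ.toℕ<n y) v {s} conserved)

  balanced-sink : ∀ n a s → Conserved (suc n) s → T (balanced n a s) → flowOut s 0 + demandSum n a ≡ flowIn s 0
  balanced-sink n a s conserved bal = +-cancelʳ-≡ _ _ _ (begin
    flowOut s 0 + demandSum n a + I                       ≡⟨ +-assoc (flowOut s 0) _ I ⟩
    flowOut s 0 + (demandSum n a + I)                     ≡⟨ cong (flowOut s 0 +_) (sumBelow-+ n (a ∘ suc) (flowIn s ∘ suc)) ⟨
    flowOut s 0 + ∑ℕ[ j < n ] (a (suc j) + flowIn s (suc j)) ≡⟨ cong (flowOut s 0 +_) (sumBelow-cong n balance) ⟨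
    flowOut s 0 + ∑ℕ[ j < n ] flowOut s (suc j)           ≡⟨ sumBelow-suc n (flowOut s) ⟨
    ∑ℕ[ j < suc n ] flowOut s j                           ≡⟨ conserved ⟩
    ∑ℕ[ j < suc n ] flowIn s j                            ≡⟨ sumBelow-suc n (flowIn s) ⟩
    flowIn s 0 + I                                        ∎)
    where
    open ≡-Reasoning
    I = ∑ℕ[ j < n ] flowIn s (suc j)
    balance : ∀ j → j < n → flowOut s (suc j) ≡ a (suc j) + flowIn s (suc j)
    balance j j<n = ≡ᵇ⇒≡ _ _ (allBelow-T n bal j j<n)

  demand : ∀ {n} → (Fin n → ℕ) → ℕ → ℕ
  demand     a zero    = 0
  demand {n} a (suc j) with j <? n
  ... | yes j<n = a (fromℕ< j<n)
  ... | no  _   = 0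

  demand-toℕ : ∀ {n} (a : Fin n → ℕ) k → demand a (suc (toℕ k)) ≡ a k
  demand-toℕ {n} a k with toℕ k <? n
  ... | yes k<n = cong a (Finₚ.fromℕ<-toℕ k k<n)
  ... | no  k≮n = contradiction (Finₚ.toℕ<n k) k≮n

  demand-positive : ∀ {n} (a : Fin n → ℕ) → (∀ k → 0 < a k) → ∀ j → j < n → 1 ≤ demand a (suc j)
  demand-positive {n} a a>0 j j<n with j <? n
  ... | yes j<n′ = a>0 (fromℕ< j<n′)
  ... | no  j≮n  = contradiction j<n j≮n

  sum-map-demand : ∀ {n} (a : Fin n → ℕ) (f : ℕ → ℕ → ℕ) →
                   sum (map (λ k → f (toℕ k) (a k)) (allFin n)) ≡ ∑ℕ[ j < n ] f j (demand a (suc j))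
  sum-map-demand {n} a f = trans (cong sum (List.map-cong (λ k → cong (f (toℕ k)) (sym (demand-toℕ a k))) (allFin n)))
                                 (sum-allFin-toℕ n (λ j → f j (demand a (suc j))))

  sumF≡demandSum : ∀ {n} (a : Fin n → ℕ) → sumF a ≡ demandSum n (demand a)
  sumF≡demandSum a = sum-map-demand a (λ _ x → x)

  excess-demand : ∀ {n} (a : Fin n → ℕ) → (∀ k → 0 < a k) → excess n (demand a) ≡ weightedSum a ∸ (suc n C 2)
  excess-demand {n} a a>0 = begin
    excess n (demand a)                                                       ≡⟨ sumBelow-weighted-pred n (demand a ∘ suc) (demand-positive a a>0) ⟩
    ∑ℕ[ j < n ] (suc j * demand a (suc j)) ∸ ∑ℕ[ j < n ] suc j                ≡⟨ cong₂ _∸_ (sum-map-demand a (λ j x → suc j * x)) (suc-C-2 n) ⟨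
    weightedSum a ∸ (suc n C 2)                                               ∎
    where open ≡-Reasoning

  weightedSum-ones : ∀ n → weightedSum {n} (λ _ → 1) ≡ suc n C 2
  weightedSum-ones n = trans (sum-allFin-toℕ n (λ j → suc j * 1))
                             (trans (sumBelow-cong n (λ j _ → *-identityʳ (suc j))) (sym (suc-C-2 n)))

  -- The condition at the sink 0 in isFlow is redundant: total outflow equals total inflow.
  isFlow≡balanced : ∀ {n} (a : Fin n → ℕ) A → isFlow a A ≡ balanced n (demand a) (accumulate A ∅)
  isFlow≡balanced {n} a A = begin
    and (map (λ k → outflow (Fin.suc k) A ≡ᵇ a k + inflow (Fin.suc k) A) (allFin n)) ∧ sinkCondition
        ≡⟨ cong (_∧ sinkCondition) (cong and (List.map-cong vertexCondition (allFin n))) ⟩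
    and (map (condition ∘ toℕ) (allFin n)) ∧ sinkCondition
        ≡⟨ cong (λ xs → and xs ∧ sinkCondition) (map-allFin-toℕ condition n) ⟩
    and (map condition (upTo n)) ∧ sinkCondition
        ≡⟨ cong (_∧ sinkCondition) (and-map-upTo n condition) ⟩
    balanced n (demand a) s ∧ sinkCondition
        ≡⟨ absorb (balanced n (demand a) s) sinkHolds ⟩
    balanced n (demand a) s ∎
    where
    open ≡-Reasoning
    s = accumulate A ∅
    condition : ℕ → Bool
    condition j = flowOut s (suc j) ≡ᵇ demand a (suc j) + flowIn s (suc j)
    sinkCondition = outflow Fin.zero A + sumF a ≡ᵇ inflow Fin.zero A
    vertexCondition : ∀ k → (outflow (Fin.suc k) A ≡ᵇ a k + inflow (Fin.suc k) A) ≡ condition (toℕ k)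
    vertexCondition k = sym (cong₂ _≡ᵇ_ (accumulate-flowOut A ∅ (Fin.suc k))
                                       (cong₂ _+_ (demand-toℕ a k) (accumulate-flowIn A ∅ (Fin.suc k))))
    sinkHolds : T (balanced n (demand a) s) → T sinkCondition
    sinkHolds bal = ≡⇒≡ᵇ _ _ (begin
      outflow Fin.zero A + sumF a                  ≡⟨ cong₂ _+_ (sym (accumulate-flowOut A ∅ Fin.zero)) (sumF≡demandSum a) ⟩
      flowOut s 0 + demandSum n (demand a)         ≡⟨ balanced-sink n (demand a) s (accumulate-conserved A refl) bal ⟩
      flowIn s 0                                   ≡⟨ accumulate-flowIn A ∅ Fin.zero ⟩
      inflow Fin.zero A                            ∎)
    absorb : ∀ b {c} → (T b → T c) → b ∧ c ≡ b
    absorb false _ = refl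
    absorb true  c = Equivalence.to T-≡ (c _)

open Flows

module RingSums {c ℓ : Level} (R : CommutativeRing c ℓ) where
  open CommutativeRing R
  open Weights R
  open import Data.Bool using (true; false; if_then_else_)
  import Data.Nat as ℕ
  import Data.Nat.Properties as ℕ
  open import Data.List using (List; []; _∷_; _++_; map; concatMap; filter; upTo)
  import Data.List.Properties as List
  open import Data.Sum using (inj₁; inj₂)
  open import Function using (_∘_)
  open import Relation.Nullary using (Dec; does)
  open import Relation.Binary.PropositionalEquality as ≡ using (_≡_)
  open import Relation.Binary.Reasoning.Setoid setoid
  open import Algebra.Solver.Ring.NaturalCoefficients.Default commutativeSemiring using (solve; _:=_; _:+_)

  if-true : ∀ {b x y} → b ≡ true → (if b then x else y) ≈ x
  if-true ≡.refl = refl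

  if-false : ∀ {b x y} → b ≡ false → (if b then x else y) ≈ y
  if-false ≡.refl = refl

  sumR-++ : ∀ xs ys → sumR (xs ++ ys) ≈ sumR xs + sumR ys
  sumR-++ []       ys = sym (+-identityˡ _)
  sumR-++ (x ∷ xs) ys = trans (+-congˡ (sumR-++ xs ys)) (sym (+-assoc _ _ _))

  private variable X Y : Set

  sumR-map-cong : ∀ {f g : X → Carrier} xs → (∀ x → f x ≈ g x) → sumR (map f xs) ≈ sumR (map g xs)
  sumR-map-cong []       eq = refl
  sumR-map-cong (x ∷ xs) eq = +-cong (eq x) (sumR-map-cong xs eq)

  sumR-map-zero : ∀ {f : X → Carrier} xs → (∀ x → f x ≈ 0#) → sumR (map f xs) ≈ 0#
  sumR-map-zero []       eq = refl
  sumR-map-zero (x ∷ xs) eq = trans (+-cong (eq x) (sumR-map-zero xs eq)) (+-identityˡ 0#)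

  sumR-map-+ : ∀ (f g : X → Carrier) xs → sumR (map (λ x → f x + g x) xs) ≈ sumR (map f xs) + sumR (map g xs)
  sumR-map-+ f g []       = sym (+-identityˡ 0#)
  sumR-map-+ f g (x ∷ xs) = trans (+-congˡ (sumR-map-+ f g xs))
    (solve 4 (λ a b c d → (a :+ b) :+ (c :+ d) := (a :+ c) :+ (b :+ d)) refl (f x) (g x) _ _)

  sumR-map-*ˡ : ∀ k (f : X → Carrier) xs → sumR (map (λ x → k * f x) xs) ≈ k * sumR (map f xs)
  sumR-map-*ˡ k f []       = sym (zeroʳ k)
  sumR-map-*ˡ k f (x ∷ xs) = trans (+-congˡ (sumR-map-*ˡ k f xs)) (sym (distribˡ k _ _))

  sumR-map-filter : ∀ {P : X → Set} (P? : ∀ x → Dec (P x)) (f : X → Carrier) xs →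
    sumR (map f (filter P? xs)) ≈ sumR (map (λ x → if does (P? x) then f x else 0#) xs)
  sumR-map-filter P? f []       = refl
  sumR-map-filter P? f (x ∷ xs) with does (P? x)
  ... | true  = +-congˡ (sumR-map-filter P? f xs)
  ... | false = trans (sumR-map-filter P? f xs) (sym (+-identityˡ _))

  sumR-map-concatMap : ∀ (f : Y → Carrier) (g : X → List Y) xs →
    sumR (map f (concatMap g xs)) ≈ sumR (map (λ x → sumR (map f (g x))) xs)
  sumR-map-concatMap f g []       = refl
  sumR-map-concatMap f g (x ∷ xs) = begin
    sumR (map f (g x ++ concatMap g xs))                ≡⟨ ≡.cong sumR (List.map-++ f (g x) _) ⟩
    sumR (map f (g x) ++ map f (concatMap g xs))        ≈⟨ sumR-++ (map f (g x)) _ ⟩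
    sumR (map f (g x)) + sumR (map f (concatMap g xs))  ≈⟨ +-congˡ (sumR-map-concatMap f g xs) ⟩
    _                                                   ∎

  sumR-map-comm : ∀ (f : X → Y → Carrier) xs ys →
    sumR (map (λ x → sumR (map (f x) ys)) xs) ≈ sumR (map (λ y → sumR (map (λ x → f x y) xs)) ys)
  sumR-map-comm f []       ys = sym (sumR-map-zero ys (λ _ → refl))
  sumR-map-comm f (x ∷ xs) ys = trans (+-congˡ (sumR-map-comm f xs ys)) (sym (sumR-map-+ (f x) _ ys))

  sumUpTo : ℕ → (ℕ → Carrier) → Carrier
  sumUpTo k f = sumR (map f (upTo k))

  syntax sumUpTo k (λ v → e) = ∑[ v < k ] e

  sumUpTo-snoc : ∀ k f → sumUpTo (suc k) f ≈ sumUpTo k f + f k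
  sumUpTo-snoc k f = begin
    sumR (map f (upTo (suc k)))         ≡⟨ ≡.cong (sumR ∘ map f) (List.upTo-∷ʳ k) ⟨
    sumR (map f (upTo k ++ k ∷ []))     ≡⟨ ≡.cong sumR (List.map-++ f (upTo k) _) ⟩
    sumR (map f (upTo k) ++ f k ∷ [])   ≈⟨ sumR-++ (map f (upTo k)) _ ⟩
    sumUpTo k f + (f k + 0#)            ≈⟨ +-congˡ (+-identityʳ _) ⟩
    sumUpTo k f + f k                   ∎

  sumUpTo-cons : ∀ k f → sumUpTo (suc k) f ≈ f 0 + ∑[ v < k ] f (suc v)
  sumUpTo-cons k f = +-congˡ (reflexive (≡.cong sumR (≡.trans (List.map-applyUpTo suc f k) (≡.sym (List.map-upTo (f ∘ suc) k)))))

  sumUpTo-cong : ∀ k {f g} → (∀ v → v ℕ.< k → f v ≈ g v) → sumUpTo k f ≈ sumUpTo k g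
  sumUpTo-cong zero    eq = refl
  sumUpTo-cong (suc k) {f} {g} eq = begin
    sumUpTo (suc k) f   ≈⟨ sumUpTo-snoc k f ⟩
    sumUpTo k f + f k   ≈⟨ +-cong (sumUpTo-cong k (λ v v<k → eq v (ℕ.m<n⇒m<1+n v<k))) (eq k ℕ.≤-refl) ⟩
    sumUpTo k g + g k   ≈⟨ sumUpTo-snoc k g ⟨
    sumUpTo (suc k) g   ∎

  sumUpTo-truncate : ∀ {r k} f → (∀ v → r ℕ.< v → f v ≈ 0#) → r ℕ.≤ k → sumUpTo (suc k) f ≈ sumUpTo (suc r) f
  sumUpTo-truncate {r} {k} f vanish r≤k with ℕ.m≤n⇒m<n∨m≡n r≤k
  ... | inj₂ ≡.refl = refl
  ... | inj₁ (ℕ.s≤s {n = k′} r≤k′) = begin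
    sumUpTo (suc (suc k′)) f           ≈⟨ sumUpTo-snoc (suc k′) f ⟩
    sumUpTo (suc k′) f + f (suc k′)    ≈⟨ +-cong (sumUpTo-truncate f vanish r≤k′) (vanish (suc k′) (ℕ.s≤s r≤k′)) ⟩
    sumUpTo (suc r) f + 0#             ≈⟨ +-identityʳ _ ⟩
    sumUpTo (suc r) f                  ∎

  pow-+ : ∀ x m n → pow x (m ℕ.+ n) ≈ pow x m * pow x n
  pow-+ x zero    n = sym (*-identityˡ _)
  pow-+ x (suc m) n = trans (*-congˡ (pow-+ x m n)) (sym (*-assoc _ _ _))


module WeightsAt0 {c ℓ : Level} (R : CommutativeRing c ℓ) (q : CommutativeRing.Carrier R) where
  open CommutativeRing R
  open Weights R
  open RingSums R
  open import Data.Bool using (if_then_else_)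
  import Data.Nat as ℕ
  import Data.Nat.Properties as ℕ
  open import Data.List using (upTo)
  open import Relation.Nullary using (yes; no)
  open import Relation.Nullary.Decidable using (dec-true; dec-false)
  open import Relation.Binary using (tri<; tri≈; tri>)
  open import Relation.Binary.PropositionalEquality as ≡ using (_≡_)
  open import Relation.Binary.Reasoning.Setoid setoid
  open import Algebra.Properties.Ring ring using (-0#≈0#; -‿anti-homo-+; -‿involutive)
  open import Algebra.Solver.Ring.NaturalCoefficients.Default commutativeSemiring using (solve; _:=_; _:+_; _:*_; con)

  -- q - 1, written as the base of the sign factor of wtFlow at t = 0.
  κ : Carrier
  κ = - ((1# - 0#) * (1# - q))

  wt₀ : ℕ → Carrier
  wt₀ = wt q 0#

  wt₀-suc : ∀ b → wt₀ (suc b) ≈ pow q b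
  wt₀-suc b = begin
    sumUpTo (suc b) term                ≈⟨ sumUpTo-snoc b term ⟩
    sumUpTo b term + term b             ≈⟨ +-cong (sumUpTo-cong b vanish) (*-congˡ (reflexive (≡.cong (pow 0#) (ℕ.n∸n≡0 b)))) ⟩
    sumUpTo b (λ _ → 0#) + pow q b * 1# ≈⟨ +-cong (sumR-map-zero (upTo b) (λ _ → refl)) (*-identityʳ _) ⟩
    0# + pow q b                        ≈⟨ +-identityˡ _ ⟩
    pow q b                             ∎
    where
    term : ℕ → Carrier
    term i = pow q i * pow 0# (b ∸ i)
    vanish : ∀ i → i ℕ.< b → term i ≈ 0#
    vanish i i<b with b ∸ i | ℕ.m<n⇒0<n∸m i<b
    ... | suc k | _ = trans (*-congˡ (zeroˡ _)) (zeroʳ _)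

  1+κ≈q : 1# + κ ≈ q
  1+κ≈q = begin
    1# + - ((1# - 0#) * (1# - q))  ≈⟨ +-congˡ (-‿cong (*-congʳ (trans (+-congˡ -0#≈0#) (+-identityʳ 1#)))) ⟩
    1# + - (1# * (1# - q))         ≈⟨ +-congˡ (-‿cong (*-identityˡ _)) ⟩
    1# + - (1# - q)                ≈⟨ +-congˡ (-‿anti-homo-+ 1# (- q)) ⟩
    1# + (- - q + - 1#)            ≈⟨ +-congˡ (+-cong (-‿involutive q) refl) ⟩
    1# + (q - 1#)                  ≈⟨ +-congˡ (+-comm q (- 1#)) ⟩
    1# + (- 1# + q)                ≈⟨ +-assoc 1# (- 1#) q ⟨
    (1# - 1#) + q                  ≈⟨ +-congʳ (-‿inverseʳ 1#) ⟩
    0# + q                         ≈⟨ +-identityˡ q ⟩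
    q                              ∎

  1+κ[r]≈qʳ : ∀ r → 1# + κ * qint q r ≈ pow q r
  1+κ[r]≈qʳ zero    = trans (+-congˡ (zeroʳ κ)) (+-identityʳ 1#)
  1+κ[r]≈qʳ (suc r) = begin
    1# + κ * qint q (suc r)              ≈⟨ +-congˡ (*-congˡ (sumUpTo-snoc r (pow q))) ⟩
    1# + κ * (qint q r + pow q r)        ≈⟨ solve 4 (λ o k s p → o :+ k :* (s :+ p) := (o :+ k :* s) :+ k :* p) refl 1# κ (qint q r) (pow q r) ⟩
    (1# + κ * qint q r) + κ * pow q r    ≈⟨ +-congʳ (1+κ[r]≈qʳ r) ⟩
    pow q r + κ * pow q r                ≈⟨ solve 2 (λ p k → p :+ k :* p := (con 1 :+ k) :* p) refl (pow q r) κ ⟩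
    (1# + κ) * pow q r                   ≈⟨ *-congʳ 1+κ≈q ⟩
    q * pow q r                          ∎

  -- Ψ t r e is the closed form of Σ_x κ^((e + #positive(x)) ∸ 1) ∏_j wt₀(x_j) q^(j x_j),
  -- the sum ranging over x : {0, …, t-1} → ℕ with Σ x = r.
  Ψ : ℕ → ℕ → ℕ → Carrier
  Ψ t zero    e = pow κ (e ∸ 1)
  Ψ t (suc r) e = pow κ e * (pow q (t ℕ.* r) * qint q t)

  Ψ-suc : ∀ t r e → ∑[ v < suc r ] (wt₀ v * (pow q (t ℕ.* v) * Ψ t (r ∸ v) (e ℕ.+ sgn v))) ≈ Ψ (suc t) r e
  Ψ-suc t zero e = begin
    1# * (pow q (t ℕ.* 0) * pow κ ((e ℕ.+ 0) ∸ 1)) + 0#  ≈⟨ +-identityʳ _ ⟩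
    1# * (pow q (t ℕ.* 0) * pow κ ((e ℕ.+ 0) ∸ 1))       ≈⟨ *-identityˡ _ ⟩
    pow q (t ℕ.* 0) * pow κ ((e ℕ.+ 0) ∸ 1)              ≡⟨ ≡.cong₂ (λ z k → pow q z * pow κ (k ∸ 1)) (ℕ.*-zeroʳ t) (ℕ.+-identityʳ e) ⟩
    1# * pow κ (e ∸ 1)                                   ≈⟨ *-identityˡ _ ⟩
    pow κ (e ∸ 1)                                        ∎
  Ψ-suc t (suc r) e = begin
    ∑[ v < suc (suc r) ] term v                          ≈⟨ sumUpTo-snoc (suc r) term ⟩
    ∑[ v < suc r ] term v + term (suc r)                 ≈⟨ +-congʳ (sumUpTo-cons r term) ⟩
    (term 0 + ∑[ u < r ] term (suc u)) + term (suc r)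
      ≈⟨ +-cong (+-cong first (trans (sumUpTo-cong r middle) (sumR-map-*ˡ (κ * Ev * A * I) (pow q) (upTo r)))) last ⟩
    (Ev * A * I + κ * Ev * A * I * qint q r) + pow q r * (pow q t * A * Ev)
      ≈⟨ solve 7 (λ E a i k G Qr Qt → E :* a :* i :+ k :* E :* a :* i :* G :+ Qr :* (Qt :* a :* E)
                                    := E :* a :* i :* (con 1 :+ k :* G) :+ Qr :* (Qt :* a :* E))
               refl Ev A I κ (qint q r) (pow q r) (pow q t) ⟩
    Ev * A * I * (1# + κ * qint q r) + pow q r * (pow q t * A * Ev)
      ≈⟨ +-congʳ (*-congˡ (1+κ[r]≈qʳ r)) ⟩
    Ev * A * I * pow q r + pow q r * (pow q t * A * Ev)
      ≈⟨ solve 5 (λ E a i Qr Qt → E :* a :* i :* Qr :+ Qr :* (Qt :* a :* E) := E :* (Qr :* a :* (i :+ Qt))) refl Ev A I (pow q r) (pow q t) ⟩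
    Ev * (pow q r * A * (I + pow q t))                   ≈⟨ *-congˡ (*-cong (pow-+ q r (t ℕ.* r)) (sumUpTo-snoc t (pow q))) ⟨
    Ψ (suc t) (suc r) e                                  ∎
    where
    term : ℕ → Carrier
    term v = wt₀ v * (pow q (t ℕ.* v) * Ψ t (suc r ∸ v) (e ℕ.+ sgn v))
    Ev = pow κ e
    A  = pow q (t ℕ.* r)
    I  = qint q t
    first : term 0 ≈ Ev * A * I
    first = begin
      1# * (pow q (t ℕ.* 0) * (pow κ (e ℕ.+ 0) * (A * I)))  ≈⟨ *-identityˡ _ ⟩
      pow q (t ℕ.* 0) * (pow κ (e ℕ.+ 0) * (A * I))         ≡⟨ ≡.cong₂ (λ z w → pow q z * (pow κ w * (A * I))) (ℕ.*-zeroʳ t) (ℕ.+-identityʳ e) ⟩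
      1# * (Ev * (A * I))                                   ≈⟨ trans (*-identityˡ _) (sym (*-assoc _ _ _)) ⟩
      Ev * A * I                                            ∎
    middle : ∀ u → u ℕ.< r → term (suc u) ≈ κ * Ev * A * I * pow q u
    middle u u<r = begin
      wt₀ (suc u) * (pow q (t ℕ.* suc u) * Ψ t (r ∸ u) (e ℕ.+ 1))
        ≈⟨ *-cong (wt₀-suc u) (*-congˡ (reflexive (≡.cong₂ (Ψ t) (ℕ.+-∸-assoc 1 u<r) (ℕ.+-comm e 1)))) ⟩
      pow q u * (pow q (t ℕ.* suc u) * (κ * Ev * (pow q (t ℕ.* k) * I)))
        ≈⟨ solve 5 (λ Qu X K Y i → Qu :* (X :* (K :* (Y :* i))) := K :* (X :* Y) :* i :* Qu) refl
                   (pow q u) (pow q (t ℕ.* suc u)) (κ * Ev) (pow q (t ℕ.* k)) I ⟩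
      κ * Ev * (pow q (t ℕ.* suc u) * pow q (t ℕ.* k)) * I * pow q u
        ≈⟨ *-congʳ (*-congʳ (*-congˡ (trans (sym (pow-+ q (t ℕ.* suc u) (t ℕ.* k))) (reflexive (≡.cong (pow q) t[1+u]+t[r-1-u]≡tr))))) ⟩
      κ * Ev * A * I * pow q u  ∎
      where
      k = r ∸ suc u
      t[1+u]+t[r-1-u]≡tr : t ℕ.* suc u ℕ.+ t ℕ.* k ≡ t ℕ.* r
      t[1+u]+t[r-1-u]≡tr = ≡.trans (≡.sym (ℕ.*-distribˡ-+ t (suc u) k)) (≡.cong (t ℕ.*_) (ℕ.m+[n∸m]≡n u<r))
    last : term (suc r) ≈ pow q r * (pow q t * A * Ev)
    last = begin
      wt₀ (suc r) * (pow q (t ℕ.* suc r) * Ψ t (r ∸ r) (e ℕ.+ 1))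
        ≈⟨ *-cong (wt₀-suc r) (*-cong (reflexive (≡.cong (pow q) (ℕ.*-suc t r))) (reflexive (≡.cong₂ (Ψ t) (ℕ.n∸n≡0 r) ≡.refl))) ⟩
      pow q r * (pow q (t ℕ.+ t ℕ.* r) * pow κ ((e ℕ.+ 1) ∸ 1))
        ≈⟨ *-congˡ (*-cong (pow-+ q t _) (reflexive (≡.cong (pow κ) (ℕ.m+n∸n≡m e 1)))) ⟩
      pow q r * (pow q t * A * Ev)  ∎

  Ψ≤ : ℕ → ℕ → ℕ → ℕ → Carrier
  Ψ≤ t A o e = if o ℕ.≤ᵇ A then Ψ t (A ∸ o) e else 0#

  Ψ≤-within : ∀ {t A o} e → o ℕ.≤ A → Ψ≤ t A o e ≈ Ψ t (A ∸ o) e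
  Ψ≤-within {A = A} {o} e o≤A = if-true (dec-true (o ℕ.≤? A) o≤A)

  Ψ≤-overshoot : ∀ {t A o} e → A ℕ.< o → Ψ≤ t A o e ≈ 0#
  Ψ≤-overshoot {A = A} {o} e A<o = if-false (dec-false (o ℕ.≤? A) (ℕ.<⇒≱ A<o))

  Ψ≤-zero : ∀ A o e → Ψ≤ 0 A o e ≈ (if o ℕ.≡ᵇ A then pow κ (e ∸ 1) else 0#)
  Ψ≤-zero A o e with ℕ.<-cmp o A
  ... | tri< o<A o≢A _ = begin
    Ψ≤ 0 A o e                  ≈⟨ Ψ≤-within e (ℕ.<⇒≤ o<A) ⟩
    Ψ 0 (A ∸ o) e               ≈⟨ Ψ0-positive (A ∸ o) (ℕ.m<n⇒0<n∸m o<A) ⟩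
    0#                          ≈⟨ if-false (dec-false (o ℕ.≟ A) o≢A) ⟨
    _                           ∎
    where
    Ψ0-positive : ∀ r → 0 ℕ.< r → Ψ 0 r e ≈ 0#
    Ψ0-positive (suc r) _ = trans (*-congˡ (zeroʳ _)) (zeroʳ _)
  ... | tri≈ _ ≡.refl _ = begin
    Ψ≤ 0 A A e                  ≈⟨ Ψ≤-within {0} {A} {A} e ℕ.≤-refl ⟩
    Ψ 0 (A ∸ A) e               ≡⟨ ≡.cong (λ r → Ψ 0 r e) (ℕ.n∸n≡0 A) ⟩
    pow κ (e ∸ 1)               ≈⟨ if-true (dec-true (A ℕ.≟ A) ≡.refl) ⟨
    _                           ∎
  ... | tri> _ o≢A A<o = trans (Ψ≤-overshoot e A<o) (sym (if-false (dec-false (o ℕ.≟ A) o≢A)))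

  Ψ≤-suc : ∀ {A S} t o e → A ℕ.≤ S →
    ∑[ v < suc S ] (wt₀ v * (pow q (t ℕ.* v) * Ψ≤ t A (o ℕ.+ v) (e ℕ.+ sgn v))) ≈ Ψ≤ (suc t) A o e
  Ψ≤-suc {A} {S} t o e A≤S with o ℕ.≤? A
  ... | no o≰A = trans (sumR-map-zero (upTo (suc S)) (λ v → vanish v (ℕ.<-≤-trans (ℕ.≰⇒> o≰A) (ℕ.m≤m+n o v))))
                       (sym (Ψ≤-overshoot e (ℕ.≰⇒> o≰A)))
    where
    vanish : ∀ v → A ℕ.< o ℕ.+ v → wt₀ v * (pow q (t ℕ.* v) * Ψ≤ t A (o ℕ.+ v) (e ℕ.+ sgn v)) ≈ 0#
    vanish v A<o+v = trans (*-congˡ (trans (*-congˡ (Ψ≤-overshoot (e ℕ.+ sgn v) A<o+v)) (zeroʳ _))) (zeroʳ _)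
  ... | yes o≤A = begin
    ∑[ v < suc S ] term v       ≈⟨ sumUpTo-truncate term overshoot (ℕ.≤-trans (ℕ.m∸n≤m A o) A≤S) ⟩
    ∑[ v < suc r ] term v       ≈⟨ sumUpTo-cong (suc r) within ⟩
    ∑[ v < suc r ] (wt₀ v * (pow q (t ℕ.* v) * Ψ t (r ∸ v) (e ℕ.+ sgn v)))  ≈⟨ Ψ-suc t r e ⟩
    Ψ (suc t) r e               ≈⟨ Ψ≤-within e o≤A ⟨
    Ψ≤ (suc t) A o e            ∎
    where
    r = A ∸ o
    term : ℕ → Carrier
    term v = wt₀ v * (pow q (t ℕ.* v) * Ψ≤ t A (o ℕ.+ v) (e ℕ.+ sgn v))
    overshoot : ∀ v → r ℕ.< v → term v ≈ 0#
    overshoot v r<v = trans (*-congˡ (trans (*-congˡ (Ψ≤-overshoot (e ℕ.+ sgn v) A<o+v)) (zeroʳ _))) (zeroʳ _)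
      where
      A<o+v : A ℕ.< o ℕ.+ v
      A<o+v = ≡.subst (ℕ._< o ℕ.+ v) (ℕ.m+[n∸m]≡n o≤A) (ℕ.+-monoʳ-< o r<v)
    within : ∀ v → v ℕ.< suc r → term v ≈ wt₀ v * (pow q (t ℕ.* v) * Ψ t (r ∸ v) (e ℕ.+ sgn v))
    within v (ℕ.s≤s v≤r) = *-congˡ (*-congˡ (trans (Ψ≤-within (e ℕ.+ sgn v) o+v≤A)
                                                 (reflexive (≡.cong (λ k → Ψ t k (e ℕ.+ sgn v)) (≡.sym (ℕ.∸-+-assoc A o v))))))
      where
      o+v≤A : o ℕ.+ v ℕ.≤ A
      o+v≤A = ≡.subst (o ℕ.+ v ℕ.≤_) (ℕ.m+[n∸m]≡n o≤A) (ℕ.+-monoʳ-≤ o v≤r)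

  Ψ-positive : ∀ t {A} e → 1 ℕ.≤ A → Ψ t A e ≈ pow κ e * (pow q (t ℕ.* (A ∸ 1)) * qint q t)
  Ψ-positive t {suc A} e _ = refl

module EdgeSums {c ℓ : Level} (R : CommutativeRing c ℓ) (q : CommutativeRing.Carrier R) (S : ℕ) where
  open CommutativeRing R
  open RingSums R
  open WeightsAt0 R q
  open import Data.List using (List; []; _∷_; _++_; upTo)
  open import Data.List.Relation.Unary.All using (All; []; _∷_)
  open import Data.List.Relation.Binary.Permutation.Propositional as ↭ using (_↭_)
  open import Relation.Binary.Reasoning.Setoid setoid
  open import Algebra.Solver.Ring.NaturalCoefficients.Default commutativeSemiring using (solve; _:=_; _:*_)

  edgeSum : List (ℕ × ℕ) → (Summary → Carrier) → Summary → Carrier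
  edgeSum []       K s = K s
  edgeSum (e ∷ es) K s = ∑[ v < suc S ] (wt₀ v * edgeSum es K (s ⊕ along e v))

  Respects≋ : (Summary → Carrier) → Set ℓ
  Respects≋ K = ∀ {s s′} → s ≋ s′ → K s ≈ K s′

  edgeSum-cong : ∀ es {K} → Respects≋ K → Respects≋ (edgeSum es K)
  edgeSum-cong []       resp s≋s′ = resp s≋s′
  edgeSum-cong (e ∷ es) resp s≋s′ = sumR-map-cong (upTo (suc S)) λ v →
    *-congˡ (edgeSum-cong es resp (⊕-congʳ (along e v) s≋s′))

  edgeSum-++ : ∀ xs ys K s → edgeSum (xs ++ ys) K s ≈ edgeSum xs (edgeSum ys K) s
  edgeSum-++ []       ys K s = refl
  edgeSum-++ (x ∷ xs) ys K s = sumR-map-cong (upTo (suc S)) λ v → *-congˡ (edgeSum-++ xs ys K (s ⊕ along x v))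

  edgeSum-*ˡ : ∀ es k K s → edgeSum es (λ s′ → k * K s′) s ≈ k * edgeSum es K s
  edgeSum-*ˡ []       k K s = refl
  edgeSum-*ˡ (e ∷ es) k K s = begin
    ∑[ v < suc S ] (wt₀ v * edgeSum es (λ s′ → k * K s′) (s ⊕ along e v))
      ≈⟨ sumR-map-cong (upTo (suc S)) (λ v → trans (*-congˡ (edgeSum-*ˡ es k K _)) (x[ky]≈k[xy] (wt₀ v) k _)) ⟩
    ∑[ v < suc S ] (k * (wt₀ v * edgeSum es K (s ⊕ along e v)))
      ≈⟨ sumR-map-*ˡ k _ (upTo (suc S)) ⟩
    k * edgeSum (e ∷ es) K s ∎
    where
    x[ky]≈k[xy] : ∀ x k y → x * (k * y) ≈ k * (x * y)
    x[ky]≈k[xy] = solve 3 (λ x k y → x :* (k :* y) := k :* (x :* y)) refl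

  edgeSum-zero : ∀ es s → edgeSum es (λ _ → 0#) s ≈ 0#
  edgeSum-zero []       s = refl
  edgeSum-zero (e ∷ es) s = sumR-map-zero (upTo (suc S)) λ v → trans (*-congˡ (edgeSum-zero es _)) (zeroʳ _)

  edgeSum-↭ : ∀ {xs ys} → xs ↭ ys → ∀ {K} → Respects≋ K → ∀ s → edgeSum xs K s ≈ edgeSum ys K s
  edgeSum-↭ ↭.refl         resp s = refl
  edgeSum-↭ (↭.prep e p)   resp s = sumR-map-cong (upTo (suc S)) λ v → *-congˡ (edgeSum-↭ p resp _)
  edgeSum-↭ (↭.trans p p′) resp s = trans (edgeSum-↭ p resp s) (edgeSum-↭ p′ resp s)
  edgeSum-↭ (↭.swap {xs} {ys} e e′ p) {K} resp s = begin
    ∑[ v < suc S ] (wt₀ v * ∑[ v′ < suc S ] (wt₀ v′ * edgeSum xs K (s ⊕ along e v ⊕ along e′ v′)))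
      ≈⟨ sumR-map-cong (upTo (suc S)) (λ v → sumR-map-*ˡ (wt₀ v) _ (upTo (suc S))) ⟨
    ∑[ v < suc S ] ∑[ v′ < suc S ] (wt₀ v * (wt₀ v′ * edgeSum xs K (s ⊕ along e v ⊕ along e′ v′)))
      ≈⟨ sumR-map-comm (λ v v′ → wt₀ v * (wt₀ v′ * edgeSum xs K (s ⊕ along e v ⊕ along e′ v′))) (upTo (suc S)) (upTo (suc S)) ⟩
    ∑[ v′ < suc S ] ∑[ v < suc S ] (wt₀ v * (wt₀ v′ * edgeSum xs K (s ⊕ along e v ⊕ along e′ v′)))
      ≈⟨ sumR-map-cong (upTo (suc S)) (λ v′ → sumR-map-cong (upTo (suc S)) (λ v → exchange v v′)) ⟩
    ∑[ v′ < suc S ] ∑[ v < suc S ] (wt₀ v′ * (wt₀ v * edgeSum ys K (s ⊕ along e′ v′ ⊕ along e v)))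
      ≈⟨ sumR-map-cong (upTo (suc S)) (λ v′ → sumR-map-*ˡ (wt₀ v′) _ (upTo (suc S))) ⟩
    ∑[ v′ < suc S ] (wt₀ v′ * ∑[ v < suc S ] (wt₀ v * edgeSum ys K (s ⊕ along e′ v′ ⊕ along e v))) ∎
    where
    exchange : ∀ v v′ → wt₀ v * (wt₀ v′ * edgeSum xs K (s ⊕ along e v ⊕ along e′ v′))
                      ≈ wt₀ v′ * (wt₀ v * edgeSum ys K (s ⊕ along e′ v′ ⊕ along e v))
    exchange v v′ = trans
      (solve 3 (λ x y z → x :* (y :* z) := y :* (x :* z)) refl (wt₀ v) (wt₀ v′) _)
      (*-congˡ (*-congˡ (trans (edgeSum-cong xs resp (⊕-swapʳ s (along e v) (along e′ v′))) (edgeSum-↭ p resp _))))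

  edgeSum-local : ∀ (P : Summary → Set) {es} → All (Preserves P) es → ∀ {K K′} →
                  (∀ {s} → P s → K s ≈ K′ s) → ∀ {s} → P s → edgeSum es K s ≈ edgeSum es K′ s
  edgeSum-local P []           K≈K′ Ps = K≈K′ Ps
  edgeSum-local P (pe ∷ pes) K≈K′ Ps = sumR-map-cong (upTo (suc S)) λ v →
    *-congˡ (edgeSum-local P pes K≈K′ (pe v Ps))

  edgeSum-shift : ∀ es {K} → Respects≋ K → ∀ d s → edgeSum es K (d ⊕ s) ≈ edgeSum es (λ s′ → K (d ⊕ s′)) s
  edgeSum-shift []       resp d s = refl
  edgeSum-shift (e ∷ es) resp d s = sumR-map-cong (upTo (suc S)) λ v →
    *-congˡ (trans (edgeSum-cong es resp (⊕-assoc d s (along e v))) (edgeSum-shift es resp d (s ⊕ along e v)))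

module FlowSums {c ℓ : Level} (R : CommutativeRing c ℓ) (q : CommutativeRing.Carrier R) (S : ℕ) where
  open CommutativeRing R
  open Weights R
  open RingSums R
  open WeightsAt0 R q
  open EdgeSums R q S
  open import Data.Bool using (if_then_else_; _∧_)
  open import Data.Bool.Properties using (∧-zeroʳ; ∧-identityʳ)
  import Data.Nat as ℕ
  import Data.Nat.Properties as ℕ
  open import Data.Product using (_,_)
  open import Data.List using (_++_; map; upTo; downFrom)
  open import Relation.Nullary using (Dec; yes; no)
  open import Relation.Nullary.Decidable using (dec-true; dec-false)
  open import Relation.Binary.PropositionalEquality as ≡ using (_≡_; _≢_)
  open import Relation.Binary.Reasoning.Setoid setoid
  open import Algebra.Solver.Ring.NaturalCoefficients.Default commutativeSemiring using (solve; _:=_; _:*_)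

  -- d counts the positive edges met above vertex m beyond one per vertex, so that the
  -- exponent of κ stays #positive - n.
  flowKernel : ℕ → (ℕ → ℕ) → ℕ → Summary → Carrier
  flowKernel m a d s = if balanced m a s then pow κ ((d ℕ.+ npos s) ∸ m) else 0#

  flowKernel-≋ : ∀ m a d → Respects≋ (flowKernel m a d)
  flowKernel-≋ m a d s≋s′@(_ , _ , pos) =
    reflexive (≡.cong₂ (λ b p → if b then pow κ ((d ℕ.+ p) ∸ m) else 0#) (balanced-≋ m a s≋s′) pos)

  module TopVertex (m A d : ℕ) where

    -- Up to a constant factor, the sum over the lower edges once the out-edges of m are fixed.
    topKernel : Summary → Carrier
    topKernel s = pow q (inflowWeight m s) * (if flowOut s m ℕ.≡ᵇ A then pow κ ((d ℕ.+ npos s) ∸ 1) else 0#)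

    edgeSum-outEdgesDown : A ℕ.≤ S → ∀ t → t ℕ.≤ m → ∀ s →
      edgeSum (map (m ,_) (downFrom t)) topKernel s ≈ pow q (inflowWeight m s) * Ψ≤ t A (flowOut s m) (d ℕ.+ npos s)
    edgeSum-outEdgesDown A≤S zero    _   s = *-congˡ (sym (Ψ≤-zero A (flowOut s m) (d ℕ.+ npos s)))
    edgeSum-outEdgesDown A≤S (suc t) t<m s = begin
      ∑[ v < suc S ] (wt₀ v * edgeSum (map (m ,_) (downFrom t)) topKernel (s ⊕ along (m , t) v))
        ≈⟨ sumR-map-cong (upTo (suc S)) (λ v → *-congˡ (edgeSum-outEdgesDown A≤S t (ℕ.<⇒≤ t<m) _)) ⟩
      ∑[ v < suc S ] (wt₀ v * (pow q (inflowWeight m (s ⊕ along (m , t) v)) * Ψ≤ t A (flowOut s m ℕ.+ pointMass m v m) (d ℕ.+ (npos s ℕ.+ sgn v))))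
        ≈⟨ sumR-map-cong (upTo (suc S)) step ⟩
      ∑[ v < suc S ] (pow q W * (wt₀ v * (pow q (t ℕ.* v) * Ψ≤ t A (o ℕ.+ v) (e ℕ.+ sgn v))))
        ≈⟨ sumR-map-*ˡ (pow q W) _ (upTo (suc S)) ⟩
      pow q W * ∑[ v < suc S ] (wt₀ v * (pow q (t ℕ.* v) * Ψ≤ t A (o ℕ.+ v) (e ℕ.+ sgn v)))
        ≈⟨ *-congˡ (Ψ≤-suc t o e A≤S) ⟩
      pow q W * Ψ≤ (suc t) A o e ∎
      where
      W = inflowWeight m s
      o = flowOut s m
      e = d ℕ.+ npos s
      step : ∀ v → wt₀ v * (pow q (inflowWeight m (s ⊕ along (m , t) v)) * Ψ≤ t A (o ℕ.+ pointMass m v m) (d ℕ.+ (npos s ℕ.+ sgn v)))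
                 ≈ pow q W * (wt₀ v * (pow q (t ℕ.* v) * Ψ≤ t A (o ℕ.+ v) (e ℕ.+ sgn v)))
      step v = begin
        wt₀ v * (pow q (inflowWeight m (s ⊕ along (m , t) v)) * Ψ≤ t A (o ℕ.+ pointMass m v m) (d ℕ.+ (npos s ℕ.+ sgn v)))
          ≡⟨ ≡.cong₂ (λ w ψ → wt₀ v * (pow q w * ψ)) (inflowWeight-along s v t<m)
               (≡.cong₂ (Ψ≤ t A) (≡.cong (o ℕ.+_) (pointMass-≡ m v)) (≡.sym (ℕ.+-assoc d (npos s) (sgn v)))) ⟩
        wt₀ v * (pow q (W ℕ.+ t ℕ.* v) * Ψ≤ t A (o ℕ.+ v) (e ℕ.+ sgn v))
          ≈⟨ *-congˡ (*-congʳ (pow-+ q W (t ℕ.* v))) ⟩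
        wt₀ v * (pow q W * pow q (t ℕ.* v) * Ψ≤ t A (o ℕ.+ v) (e ℕ.+ sgn v))
          ≈⟨ solve 4 (λ x y z u → x :* (y :* z :* u) := y :* (x :* (z :* u))) refl (wt₀ v) (pow q W) (pow q (t ℕ.* v)) _ ⟩
        pow q W * (wt₀ v * (pow q (t ℕ.* v) * Ψ≤ t A (o ℕ.+ v) (e ℕ.+ sgn v))) ∎

  EdgeSumFormula : ℕ → Set ℓ
  EdgeSumFormula m = ∀ a d → (∀ j → j ℕ.< m → 1 ℕ.≤ a (suc j)) → demandSum m a ℕ.≤ S →
    edgeSum (edgesDown m) (flowKernel m a d) ∅ ≈ pow κ d * (pow q (excess m a) * qfact q m)

  module _ {m : ℕ} (a : ℕ → ℕ) (d : ℕ) {s : Summary} (st : TopVertexState (suc m) s) where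
    open TopVertexState st

    private
      topCondition : ∀ {s′} → Untouched (suc m) s′ →
        (flowOut (s ⊕ s′) (suc m) ℕ.≡ᵇ a (suc m) ℕ.+ flowIn (s ⊕ s′) (suc m)) ≡ (flowOut s (suc m) ℕ.≡ᵇ a (suc m))
      topCondition (out′≡0 , in′≡0) = ≡.cong₂ ℕ._≡ᵇ_
        (≡.trans (≡.cong (flowOut s (suc m) ℕ.+_) out′≡0) (ℕ.+-identityʳ _))
        (≡.trans (≡.cong (a (suc m) ℕ.+_) (≡.cong₂ ℕ._+_ noInflowAtTop in′≡0)) (ℕ.+-identityʳ _))

    flowKernel-mismatch : flowOut s (suc m) ≢ a (suc m) → ∀ {s′} → Untouched (suc m) s′ →
                          flowKernel (suc m) a d (s ⊕ s′) ≈ 0#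
    flowKernel-mismatch o≢a {s′} u = if-false (≡.trans
      (≡.cong (balanced m a (s ⊕ s′) ∧_) (≡.trans (topCondition {s′} u) (dec-false (_ ℕ.≟ _) o≢a)))
      (∧-zeroʳ _))

    flowKernel-match : flowOut s (suc m) ≡ a (suc m) → 1 ℕ.≤ a (suc m) → ∀ {s′} → Untouched (suc m) s′ →
                       flowKernel (suc m) a d (s ⊕ s′) ≡ flowKernel m (λ j → a j ℕ.+ flowIn s j) (d ℕ.+ npos s ∸ 1) s′
    flowKernel-match o≡a a≥1 {s′} u = ≡.cong₂ (λ b k → if b then pow κ k else 0#)
      (≡.trans (≡.cong (balanced m a (s ⊕ s′) ∧_) (≡.trans (topCondition {s′} u) (dec-true (_ ℕ.≟ _) o≡a)))
        (≡.trans (∧-identityʳ _) (balanced-⊕ m a s s′ (λ j j<m → outElsewhere (suc j) (ℕ.<⇒≢ (ℕ.s≤s j<m))))))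
      (d+[p+p′]∸[1+m] d (npos s′) m (positive (≡.subst (0 ℕ.<_) (≡.sym o≡a) a≥1)))

  edgeSum-lowerEdges : ∀ m → EdgeSumFormula m → ∀ a d → (∀ j → j ℕ.< suc m → 1 ℕ.≤ a (suc j)) →
    demandSum (suc m) a ℕ.≤ S → ∀ {s} → TopVertexState (suc m) s →
    edgeSum (edgesDown m) (flowKernel (suc m) a d) s ≈ pow q (excess m a) * qfact q m * TopVertex.topKernel (suc m) (a (suc m)) d s
  edgeSum-lowerEdges m ih a d a≥1 ΣA≤S {s} st = begin
    edgeSum (edgesDown m) K s                      ≈⟨ edgeSum-cong (edgesDown m) (flowKernel-≋ (suc m) a d) (≋-sym (⊕-identityʳ s)) ⟩
    edgeSum (edgesDown m) K (s ⊕ ∅)                ≈⟨ edgeSum-shift (edgesDown m) (flowKernel-≋ (suc m) a d) s ∅ ⟩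
    edgeSum (edgesDown m) (λ s′ → K (s ⊕ s′)) ∅    ≈⟨ byTopOutflow (flowOut s (suc m) ℕ.≟ a (suc m)) ⟩
    L * topKernel s                                ∎
    where
    open TopVertexState st
    open TopVertex (suc m) (a (suc m)) d
    K = flowKernel (suc m) a d
    L = pow q (excess m a) * qfact q m
    W = inflowWeight (suc m) s
    onLowerEdges : ∀ {K′} → (∀ {s′} → Untouched (suc m) s′ → K (s ⊕ s′) ≈ K′ s′) →
                   edgeSum (edgesDown m) (λ s′ → K (s ⊕ s′)) ∅ ≈ edgeSum (edgesDown m) K′ ∅
    onLowerEdges K≈K′ = edgeSum-local (Untouched (suc m)) (edgesDown-untouched m) K≈K′ (≡.refl , ≡.refl)
    byTopOutflow : Dec (flowOut s (suc m) ≡ a (suc m)) → edgeSum (edgesDown m) (λ s′ → K (s ⊕ s′)) ∅ ≈ L * topKernel s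
    byTopOutflow (no o≢a) = begin
      edgeSum (edgesDown m) (λ s′ → K (s ⊕ s′)) ∅  ≈⟨ onLowerEdges (λ {s′} → flowKernel-mismatch a d st o≢a {s′}) ⟩
      edgeSum (edgesDown m) (λ _ → 0#) ∅           ≈⟨ edgeSum-zero (edgesDown m) ∅ ⟩
      0#                                           ≈⟨ trans (*-congˡ (trans (*-congˡ (if-false (dec-false (_ ℕ.≟ _) o≢a))) (zeroʳ _))) (zeroʳ L) ⟨
      L * topKernel s                              ∎
    byTopOutflow (yes o≡a) = begin
      edgeSum (edgesDown m) (λ s′ → K (s ⊕ s′)) ∅
        ≈⟨ onLowerEdges (λ {s′} u → reflexive (flowKernel-match a d st o≡a (a≥1 m ℕ.≤-refl) {s′} u)) ⟩
      edgeSum (edgesDown m) (flowKernel m a′ d′) ∅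
        ≈⟨ ih a′ d′ a′≥1 Σa′≤S ⟩
      pow κ d′ * (pow q (excess m a′) * qfact q m)
        ≡⟨ ≡.cong (λ k → pow κ d′ * (pow q k * qfact q m)) (excess-+ m a (flowIn s) (λ j j<m → a≥1 j (ℕ.m<n⇒m<1+n j<m))) ⟩
      pow κ d′ * (pow q (excess m a ℕ.+ W) * qfact q m)
        ≈⟨ *-congˡ (*-congʳ (pow-+ q (excess m a) W)) ⟩
      pow κ d′ * (pow q (excess m a) * pow q W * qfact q m)
        ≈⟨ solve 4 (λ k x w f → k :* (x :* w :* f) := x :* f :* (w :* k)) refl (pow κ d′) (pow q (excess m a)) (pow q W) (qfact q m) ⟩
      L * (pow q W * pow κ d′)
        ≈⟨ *-congˡ (*-congˡ (if-true (dec-true (_ ℕ.≟ _) o≡a))) ⟨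
      L * topKernel s                              ∎
      where
      a′ : ℕ → ℕ
      a′ j = a j ℕ.+ flowIn s j
      d′ = d ℕ.+ npos s ∸ 1
      a′≥1 : ∀ j → j ℕ.< m → 1 ℕ.≤ a′ (suc j)
      a′≥1 j j<m = ℕ.≤-trans (a≥1 j (ℕ.m<n⇒m<1+n j<m)) (ℕ.m≤m+n _ _)
      Σa′≤S : demandSum m a′ ℕ.≤ S
      Σa′≤S = ℕ.≤-trans (demandSum-+ m a (flowIn s))
                (ℕ.≤-trans (ℕ.≤-reflexive (≡.cong (demandSum m a ℕ.+_) (≡.trans (≡.sym outflow≡inflow) o≡a))) ΣA≤S)

  edgeSum-edgesDown : ∀ m → EdgeSumFormula m
  edgeSum-edgesDown zero    a d _ _ = begin
    pow κ (d ℕ.+ 0)                  ≡⟨ ≡.cong (pow κ) (ℕ.+-identityʳ d) ⟩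
    pow κ d                          ≈⟨ trans (*-congˡ (*-identityʳ _)) (*-identityʳ _) ⟨
    pow κ d * (1# * 1#)              ∎
  edgeSum-edgesDown (suc m) a d a≥1 ΣA≤S = begin
    edgeSum (outEdgesDown (suc m) ++ edgesDown m) K ∅
      ≈⟨ edgeSum-++ (outEdgesDown (suc m)) (edgesDown m) K ∅ ⟩
    edgeSum (outEdgesDown (suc m)) (edgeSum (edgesDown m) K) ∅
      ≈⟨ edgeSum-local (TopVertexState (suc m)) (outEdgesDown-topVertexState (suc m))
                       (edgeSum-lowerEdges m (edgeSum-edgesDown m) a d a≥1 ΣA≤S) (topVertexState-∅ (suc m)) ⟩
    edgeSum (outEdgesDown (suc m)) (λ s → L * topKernel s) ∅
      ≈⟨ edgeSum-*ˡ (outEdgesDown (suc m)) L topKernel ∅ ⟩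
    L * edgeSum (outEdgesDown (suc m)) topKernel ∅
      ≈⟨ *-congˡ (edgeSum-outEdgesDown A≤S (suc m) ℕ.≤-refl ∅) ⟩
    L * (pow q (inflowWeight (suc m) ∅) * Ψ (suc m) A (d ℕ.+ 0))
      ≡⟨ ≡.cong₂ (λ w e → L * (pow q w * Ψ (suc m) A e)) (sumBelow-zero (suc m) (λ j _ → ℕ.*-zeroʳ j)) (ℕ.+-identityʳ d) ⟩
    L * (1# * Ψ (suc m) A d)
      ≈⟨ *-congˡ (trans (*-identityˡ _) (Ψ-positive (suc m) d (a≥1 m ℕ.≤-refl))) ⟩
    L * (pow κ d * (pow q (suc m ℕ.* (A ∸ 1)) * qint q (suc m)))
      ≈⟨ solve 5 (λ x f k y i → x :* f :* (k :* (y :* i)) := k :* (x :* y :* (i :* f))) refl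
                 (pow q (excess m a)) (qfact q m) (pow κ d) (pow q (suc m ℕ.* (A ∸ 1))) (qint q (suc m)) ⟩
    pow κ d * (pow q (excess m a) * pow q (suc m ℕ.* (A ∸ 1)) * qfact q (suc m))
      ≈⟨ *-congˡ (*-congʳ (pow-+ q (excess m a) _)) ⟨
    pow κ d * (pow q (excess (suc m) a) * qfact q (suc m))   ∎
    where
    A = a (suc m)
    open TopVertex (suc m) A d
    K = flowKernel (suc m) a d
    L = pow q (excess m a) * qfact q m
    A≤S : A ℕ.≤ S
    A≤S = ℕ.≤-trans (ℕ.m≤n+m A (demandSum m a)) ΣA≤S

module Ehrhart {c ℓ : Level} (R : CommutativeRing c ℓ) (q : CommutativeRing.Carrier R) where
  open CommutativeRing R
  open Weights R
  open RingSums R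
  open WeightsAt0 R q
  open import Data.Bool using (true; false; if_then_else_)
  import Data.Nat as ℕ
  import Data.Nat.Properties as ℕ
  open import Data.Product using (_,_; proj₂)
  open import Data.List using (List; []; _∷_; map; concatMap; upTo)
  import Data.List.Properties as List
  open import Relation.Nullary.Decidable using (T?)
  open import Relation.Binary.PropositionalEquality as ≡ using (_≡_)
  open import Relation.Binary.Reasoning.Setoid setoid

  weight : ∀ {n} → Labelling n → Carrier
  weight A = prodR (map (λ e → wt₀ (proj₂ e)) A)

  accumulate-npos : ∀ {n} (A : Labelling n) s → npos (accumulate A s) ≡ npos s ℕ.+ numPositive A
  accumulate-npos []                 s = ≡.sym (ℕ.+-identityʳ _)
  accumulate-npos ((e , zero)  ∷ A) s = ≡.trans (accumulate-npos A _) (≡.cong (ℕ._+ numPositive A) (ℕ.+-identityʳ (npos s)))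
  accumulate-npos ((e , suc v) ∷ A) s = ≡.trans (accumulate-npos A _) (ℕ.+-assoc (npos s) 1 _)

  module _ (S : ℕ) where
    open EdgeSums R q S

    sum-labellings : ∀ {n} (es : List (Edge n)) K s →
      sumR (map (λ A → weight A * K (accumulate A s)) (labellings es S)) ≈ edgeSum (map edgeToℕ es) K s
    sum-labellings []       K s = trans (+-identityʳ _) (*-identityˡ _)
    sum-labellings (e ∷ es) K s = begin
      sumR (map F (concatMap (λ v → map ((e , v) ∷_) (labellings es S)) (upTo (suc S))))
        ≈⟨ sumR-map-concatMap F (λ v → map ((e , v) ∷_) (labellings es S)) (upTo (suc S)) ⟩
      ∑[ v < suc S ] sumR (map F (map ((e , v) ∷_) (labellings es S)))
        ≈⟨ sumR-map-cong (upTo (suc S)) extend ⟩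
      ∑[ v < suc S ] (wt₀ v * edgeSum (map edgeToℕ es) K (s ⊕ along (edgeToℕ e) v)) ∎
      where
      F : _ → Carrier
      F A = weight A * K (accumulate A s)
      extend : ∀ v → sumR (map F (map ((e , v) ∷_) (labellings es S))) ≈ wt₀ v * edgeSum (map edgeToℕ es) K (s ⊕ along (edgeToℕ e) v)
      extend v = begin
        sumR (map F (map ((e , v) ∷_) (labellings es S)))
          ≡⟨ ≡.cong sumR (List.map-∘ (labellings es S)) ⟨
        sumR (map (λ A → wt₀ v * weight A * K (accumulate A (s ⊕ along (edgeToℕ e) v))) (labellings es S))
          ≈⟨ sumR-map-cong (labellings es S) (λ A → *-assoc (wt₀ v) _ _) ⟩
        sumR (map (λ A → wt₀ v * (weight A * K (accumulate A (s ⊕ along (edgeToℕ e) v)))) (labellings es S))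
          ≈⟨ sumR-map-*ˡ (wt₀ v) _ (labellings es S) ⟩
        wt₀ v * sumR (map (λ A → weight A * K (accumulate A (s ⊕ along (edgeToℕ e) v))) (labellings es S))
          ≈⟨ *-congˡ (sum-labellings es K _) ⟩
        wt₀ v * edgeSum (map edgeToℕ es) K (s ⊕ along (edgeToℕ e) v) ∎

  Ehr-formula : ∀ n (a : Fin n → ℕ) → (∀ k → 0 < a k) → Ehr q 0# n a ≈ pow q (weightedSum a ∸ (suc n C 2)) * qfact q n
  Ehr-formula n a a>0 = begin
    Ehr q 0# n a
      ≈⟨ sumR-map-filter (λ A → T? (isFlow a A)) (wtFlow q 0# n) (labellings (edges n) S) ⟩
    sumR (map (λ A → if isFlow a A then wtFlow q 0# n A else 0#) (labellings (edges n) S))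
      ≈⟨ sumR-map-cong (labellings (edges n) S) summand ⟩
    sumR (map (λ A → weight A * K (accumulate A ∅)) (labellings (edges n) S))
      ≈⟨ sum-labellings S (edges n) K ∅ ⟩
    edgeSum (map edgeToℕ (edges n)) K ∅
      ≡⟨ ≡.cong (λ es → edgeSum es K ∅) (map-edgeToℕ-edges n) ⟩
    edgeSum (edgesUp n) K ∅
      ≈⟨ edgeSum-↭ (edgesUp↭edgesDown n) (flowKernel-≋ n (demand a) 0) ∅ ⟩
    edgeSum (edgesDown n) K ∅
      ≈⟨ edgeSum-edgesDown n (demand a) 0 (demand-positive a a>0) (ℕ.≤-reflexive (≡.sym (sumF≡demandSum a))) ⟩
    1# * (pow q (excess n (demand a)) * qfact q n)
      ≈⟨ *-identityˡ _ ⟩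
    pow q (excess n (demand a)) * qfact q n
      ≡⟨ ≡.cong (λ k → pow q k * qfact q n) (excess-demand a a>0) ⟩
    pow q (weightedSum a ∸ (suc n C 2)) * qfact q n ∎
    where
    S = sumF a
    open EdgeSums R q S
    open FlowSums R q S
    K = flowKernel n (demand a) 0
    summand : ∀ A → (if isFlow a A then wtFlow q 0# n A else 0#) ≈ weight A * K (accumulate A ∅)
    summand A rewrite isFlow≡balanced a A with balanced n (demand a) (accumulate A ∅)
    ... | true  = trans (*-comm _ _) (*-congˡ (reflexive (≡.cong (λ p → pow κ (p ∸ n)) (≡.sym (accumulate-npos A ∅)))))
    ... | false = sym (zeroʳ _)

  Ehr-ones : ∀ n → Ehr q 0# n (λ _ → 1) ≈ qfact q n
  Ehr-ones n = begin
    Ehr q 0# n (λ _ → 1)                                          ≈⟨ Ehr-formula n (λ _ → 1) (λ _ → ℕ.s≤s ℕ.z≤n) ⟩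
    pow q (weightedSum {n} (λ _ → 1) ∸ (suc n C 2)) * qfact q n   ≡⟨ ≡.cong (λ k → pow q (k ∸ (suc n C 2)) * qfact q n) (weightedSum-ones n) ⟩
    pow q ((suc n C 2) ∸ (suc n C 2)) * qfact q n                 ≡⟨ ≡.cong (λ k → pow q k * qfact q n) (ℕ.n∸n≡0 (suc n C 2)) ⟩
    1# * qfact q n                                                ≈⟨ *-identityˡ _ ⟩
    qfact q n                                                     ∎

corollary4p4 : {c ℓ : Level} (R : CommutativeRing c ℓ) → let open CommutativeRing R in let open Weights R in
    (n : ℕ) (a : Fin n → ℕ) → (∀ i → 0 < a i) → (q : Carrier) →
      (Ehr q 0# n a ≈ pow q (weightedSum a ∸ (suc n C 2)) * qfact q n)
      × (Ehr q 0# n (λ _ → 1) ≈ qfact q n)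
corollary4p4 R n a a>0 q = Ehr-formula n a a>0 , Ehr-ones n
  where open Ehrhart R q
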